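{- Let $n$ be a positive integer, $\mathbf a=(1,\dots,1)\in\mathbb N^n$ and $\mathbf b=(0,1,\dots,1)\in\mathbb N^n$. Then $$\sum_{m\ge0}v^{(n,m)}(\mathbf a,\mathbf b)\,x^m=\frac{\sum_{k=1}^nA(n,k)\,x^{k-1}}{(1-x)^{n+1}}.$$
   Context: For a positive integer $m$, $G(n,m)$ is the directed graph with vertices $\{(i,j):1\le i\le n,0\le j\le m\}\cup\{s\}$ and edges $((i,j),(i,j+1))$ ($1\le i\le n$, $0\le j\le m-1$), $((i,j),(i+1,j))$ ($1\le i\le n-1$, $0\le j\le m$), $((n,j),s)$ ($0\le j\le m$). $\mathcal F_{G(n,m)}(\mathbf a,\mathbf b)$ is the polytope of $f:E\to\mathbb R_{\ge0}$ with outflow minus inflow equal to $a_i$ at $(i,0)$, $-b_i$ at $(i,m)$, $-\sum a_i+\sum b_i$ at $s$, $0$ elsewhere, and $v^{(n,m)}(\mathbf a,\mathbf b)$ is its number of vertices; the $m=0$ term is taken to be $1$. $A(n,k)$ is the Eulerian number: the number of permutations $w$ of $\{1,\dots,n\}$ with exactly $k-1$ descents (positions $i$ with $w_i>w_{i+1}$).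
   Formalization: The flows in $\mathcal F_{G(n,m)}(\mathbf a,\mathbf b)$ take values in ℚ instead of ℝ, and its vertices are counted as extreme points among rational flows. -}

module Defs where

open import Data.Nat as ℕ using (ℕ; zero; suc)
open import Data.Fin as Fin using (Fin; inject₁; fromℕ)
open import Data.Fin.Properties as FinP using ()
open import Data.List as L using (List; []; _∷_; concatMap; allFin; length; filter; foldr)
open import Data.List.Relation.Unary.Unique.Propositional using (Unique)
open import Data.List.Membership.Propositional using (_∈_)
open import Data.Vec as V using (Vec; lookup)
open import Data.Rational as ℚ using (ℚ; 0ℚ; 1ℚ)
open import Data.Integer as ℤ using (ℤ)
open import Data.Product using (_×_; _,_; proj₁; proj₂)
open import Relation.Binary.PropositionalEquality using (_≡_; _≢_)
open import Relation.Nullary using (Dec; yes; no; ¬_)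
open import Relation.Nullary.Decidable using (map′)

-- The graph G(n,m), with n = suc n' (so rows are Fin (suc n')) and
-- columns j ∈ {0,…,m} = Fin (suc m).

data Vertex (n m : ℕ) : Set where
  node : Fin n → Fin (suc m) → Vertex n m
  sink : Vertex n m

_≟V_ : ∀ {n m} (u v : Vertex n m) → Dec (u ≡ v)
node i j ≟V node i′ j′ with i FinP.≟ i′ | j FinP.≟ j′
... | yes _≡_.refl | yes _≡_.refl = yes _≡_.refl
... | no ne | _ = no λ { _≡_.refl → ne _≡_.refl }
... | yes _ | no ne = no λ { _≡_.refl → ne _≡_.refl }
node _ _ ≟V sink = no λ ()
sink ≟V node _ _ = no λ ()
sink ≟V sink = yes _≡_.refl

Edge : ℕ → ℕ → Set
Edge n m = Vertex n m × Vertex n m   -- (tail , head)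

edges : (n' m : ℕ) → List (Edge (suc n') m)
edges n' m =
     concatMap (λ i → L.map (λ j → node i (inject₁ j) , node i (Fin.suc j)) (allFin m)) (allFin (suc n'))
  L.++ concatMap (λ i → L.map (λ j → node (inject₁ i) j , node (Fin.suc i) j) (allFin (suc m))) (allFin n')
  L.++ L.map (λ j → node (fromℕ n') j , sink) (allFin (suc m))

#E : ℕ → ℕ → ℕ
#E n' m = length (edges n' m)

-- A flow assigns a rational to each edge (indexed by position in the list).
Flow : ℕ → ℕ → Set
Flow n' m = Vec ℚ (#E n' m)

indicator : ∀ {n m} → Vertex n m → Vertex n m → ℚ → ℚ
indicator u v q with u ≟V v
... | yes _ = q
... | no _ = 0ℚ

netFlow : ∀ n' m → Flow n' m → Vertex (suc n') m → ℚ
netFlow n' m f v =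
  foldr ℚ._+_ 0ℚ
    (L.map (λ k → let e = L.lookup (edges n' m) k in
                  indicator (proj₁ e) v (lookup f k) ℚ.- indicator (proj₂ e) v (lookup f k))
           (allFin (#E n' m)))

toℚ : ℕ → ℚ
toℚ k = ℤ.+ k ℚ./ 1

sumℕ : ∀ {n} → (Fin n → ℕ) → ℕ
sumℕ {n} a = foldr ℕ._+_ 0 (L.map a (allFin n))

-- prescribed net flow (m ≥ 1 is assumed when this is used)
demand : ∀ n' m → (a b : Fin (suc n') → ℕ) → Vertex (suc n') m → ℚ
demand n' m a b (node i j) =
  (if0 j (toℚ (a i))) ℚ.- (ifm j (toℚ (b i)))
  where
    if0 : Fin (suc m) → ℚ → ℚ
    if0 Fin.zero q = q
    if0 (Fin.suc _) q = 0ℚ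
    ifm : Fin (suc m) → ℚ → ℚ
    ifm j q with Fin.toℕ j ℕ.≟ m
    ... | yes _ = q
    ... | no _ = 0ℚ
demand n' m a b sink = toℚ (sumℕ b) ℚ.- toℚ (sumℕ a)

InPolytope : ∀ n' m → (a b : Fin (suc n') → ℕ) → Flow n' m → Set
InPolytope n' m a b f =
  (∀ k → 0ℚ ℚ.≤ lookup f k) × (∀ v → netFlow n' m f v ≡ demand n' m a b v)

IsVertex : ∀ n' m → (a b : Fin (suc n') → ℕ) → Flow n' m → Set
IsVertex n' m a b f =
  InPolytope n' m a b f ×
  (∀ g h (t : ℚ) → InPolytope n' m a b g → InPolytope n' m a b h →
     0ℚ ℚ.< t → t ℚ.< 1ℚ →
     f ≡ V.zipWith ℚ._+_ (V.map (t ℚ.*_) g) (V.map ((1ℚ ℚ.- t) ℚ.*_) h) →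
     g ≡ h)

HasVertexCount : ∀ n' m → (a b : Fin (suc n') → ℕ) → ℕ → Set
HasVertexCount n' m a b c =
  Σ' (List (Flow n' m)) λ L →
    Unique L × (∀ f → f ∈ L → IsVertex n' m a b f)
    × (∀ f → IsVertex n' m a b f → f ∈ L) × (length L ≡ c)
  where open import Data.Product using () renaming (Σ to Σ')

allVecs : (n k : ℕ) → List (Vec (Fin n) k)
allVecs n zero = V.[] ∷ []
allVecs n (suc k) = concatMap (λ x → L.map (x V.∷_) (allVecs n k)) (allFin n)

perms : (n : ℕ) → List (List (Fin n))
perms n = filter unique? (L.map V.toList (allVecs n n))
  where open import Data.List.Relation.Unary.Unique.DecPropositional (FinP._≟_ {n}) using (unique?)

des : ∀ {n} → List (Fin n) → ℕ
des [] = 0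
des (x ∷ w) = go x w
  where
    go : _ → List _ → ℕ
    go x [] = 0
    go x (y ∷ w) with y Fin.<? x
    ... | yes _ = suc (go y w)
    ... | no _ = go y w

-- Eulerian number A(n,k): permutations with exactly k-1 descents (k ≥ 1; A(n,0)=0)
eulerian : ℕ → ℕ → ℕ
eulerian n zero = 0
eulerian n (suc k) = length (filter (λ w → des w ℕ.≟ k) (perms n))

Series : Set
Series = ℕ → ℤ

_·_ : Series → Series → Series
(p · q) m = foldr ℤ._+_ (ℤ.+ 0) (L.map (λ j → p j ℤ.* q (m ℕ.∸ j)) (L.upTo (suc m)))

oneSeries : Series
oneSeries zero = ℤ.+ 1
oneSeries (suc _) = ℤ.+ 0

oneMinusX : Series
oneMinusX zero = ℤ.+ 1
oneMinusX (suc zero) = ℤ.- (ℤ.+ 1)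
oneMinusX (suc (suc _)) = ℤ.+ 0

_^ˢ_ : Series → ℕ → Series
p ^ˢ zero = oneSeries
p ^ˢ suc k = p · (p ^ˢ k)

aVec : ∀ {n} → Fin n → ℕ
aVec _ = 1

bVec : ∀ {n} → Fin n → ℕ
bVec Fin.zero = 0
bVec (Fin.suc _) = 1

eulerNumerator : ℕ → Series
eulerNumerator n d with d ℕ.<? n
... | yes _ = ℤ.+ eulerian n (suc d)
... | no _ = ℤ.+ 0

module Submission where

-- Write n = n′ + 1 and m = m₀ + 1.  A flow in F_{G(n,m)}(a,b) is determined by the amounts
-- d(i,c) leaving the nodes (i,c) downwards (to row i+1, or to the sink from the last row):
-- conservation along row i forces the flow on its horizontal edges to be
-- 1 + (inflow from above up to column j) − (outflow downwards up to column j), and, row by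
-- row, forces each d(i,·) to be a probability vector on the m+1 columns.  Conversely every
-- family of n probability vectors gives a feasible flow, because those partial sums are at
-- most 1.  This affine bijection with a product of n simplices of dimension m shows that the
-- vertices are the (m+1)^n choices of one column in every row.
--
-- The series identity is then Worpitzky's identity (m+1)^n = Σ_w C(n+m−des w, n) over the
-- permutations w of [n], proved by induction on n by inserting the smallest letter into a
-- permutation, together with (1−x)^{n+1} Σ_{m≥k} C(n+m−k, n) x^m = x^k.

module Iverson {A : Set} (0# 1# : A) where

  open import Data.Bool using (if_then_else_)
  open import Function using (_∘_)
  open import Relation.Binary.PropositionalEquality using (_≡_; refl; sym)
  open import Relation.Nullary using (Dec; yes; no; does; ¬_; contradiction)

  𝟙 : ∀ {p} {P : Set p} → Dec P → A
  𝟙 d = if does d then 1# else 0#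

  𝟙-yes : ∀ {p} {P : Set p} (d : Dec P) → P → 𝟙 d ≡ 1#
  𝟙-yes (yes _) _ = refl
  𝟙-yes (no ¬p) p = contradiction p ¬p

  𝟙-no : ∀ {p} {P : Set p} (d : Dec P) → ¬ P → 𝟙 d ≡ 0#
  𝟙-no (yes p) ¬p = contradiction p ¬p
  𝟙-no (no _) _ = refl

  𝟙-cong : ∀ {p q} {P : Set p} {Q : Set q} → (P → Q) → (Q → P) → (d : Dec P) (e : Dec Q) → 𝟙 d ≡ 𝟙 e
  𝟙-cong f g (yes p) e = sym (𝟙-yes e (f p))
  𝟙-cong f g (no ¬p) e = sym (𝟙-no e (¬p ∘ g))

module Worpitzky where

  open import Defs using (des; eulerian; allVecs)
  import Algebra.Properties.Semiring.Sum as SemiringSum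
  open import Data.Bool using (true; false)
  open import Data.Fin as Fin using (Fin; toℕ)
  import Data.Fin.Properties as Finₚ
  open import Data.List as List using (List; []; _∷_; map)
  open import Data.List.Membership.Propositional using (_∈_)
  open import Data.List.Properties using (map-++; map-∘; map-tabulate)
  open import Data.List.Relation.Binary.Permutation.Propositional using (_↭_; ↭-refl; ↭-prep; ↭-swap; ↭-trans; ↭-sym; ↭⇒↭ₛ)
  import Data.List.Relation.Binary.Permutation.Setoid.Properties
  open import Data.List.Relation.Unary.All as All using ([]; _∷_)
  open import Data.List.Relation.Unary.All.Properties as Allₚ using (All¬⇒¬Any)
  open import Data.List.Relation.Unary.AllPairs using (_∷_)
  open import Data.List.Relation.Unary.Any using (here; there)
  open import Data.List.Relation.Unary.Unique.Propositional as Unique using (Unique)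
  import Data.List.Relation.Unary.Unique.Propositional.Properties as Uniqueₚ
  open import Data.Nat as ℕ using (ℕ; zero; suc; _+_; _*_; _∸_; _≤_; _<_; _^_; z≤n; s≤s; _≟_)
  open import Data.Nat.Combinatorics using (_C_; nC1≡n; k>n⇒nCk≡0; nCk+nC[k+1]≡[n+1]C[k+1])
  open import Data.Nat.ListAction using () renaming (sum to sumList)
  open import Data.Nat.ListAction.Properties using () renaming (sum-++ to sumList-++)
  open import Data.Nat.Properties
  open import Data.Nat.Solver using (module +-*-Solver)
  open import Data.Product using (_,_)
  import Data.Vec as Vec
  open import Function using (_∘_)
  open import Function.Bundles using (_⇔_; mk⇔; Equivalence)
  open import Relation.Binary.PropositionalEquality
  open import Relation.Nullary
  open import Relation.Unary using (Decidable)
  open Iverson 0 1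
  open SemiringSum +-*-semiring
  open +-*-Solver

  𝟙≤1 : ∀ {p} {P : Set p} (d : Dec P) → 𝟙 d ≤ 1
  𝟙≤1 (yes _) = s≤s z≤n
  𝟙≤1 (no _) = z≤n

  unique? : ∀ {N} → (w : List (Fin N)) → Dec (Unique w)
  unique? {N} = U.unique?
    where import Data.List.Relation.Unary.Unique.DecPropositional (Finₚ._≟_ {N}) as U

  sumWords : ∀ N (L : ℕ) → (List (Fin N) → ℕ) → ℕ
  sumWords N zero g = g []
  sumWords N (suc L) g = sum (λ x → sumWords N L (λ w → g (x ∷ w)))

  sumWords-cong : ∀ N L {f g : List (Fin N) → ℕ} →
                  (∀ w → List.length w ≡ L → f w ≡ g w) → sumWords N L f ≡ sumWords N L g
  sumWords-cong N zero e = e [] refl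
  sumWords-cong N (suc L) e = sum-cong-≗ (λ x → sumWords-cong N L (λ w → e (x ∷ w) ∘ cong suc))

  *-distribˡ-sumWords : ∀ N L c (f : List (Fin N) → ℕ) → c * sumWords N L f ≡ sumWords N L (λ w → c * f w)
  *-distribˡ-sumWords N zero c f = refl
  *-distribˡ-sumWords N (suc L) c f =
    trans (*-distribˡ-sum c (λ x → sumWords N L (f ∘ (x ∷_)))) (sum-cong-≗ (λ x → *-distribˡ-sumWords N L c (f ∘ (x ∷_))))

  sumWords-zero : ∀ N L (f : List (Fin N) → ℕ) → (∀ w → List.length w ≡ L → f w ≡ 0) → sumWords N L f ≡ 0
  sumWords-zero N L f e = trans (sumWords-cong N L e) (sym (*-distribˡ-sumWords N L 0 (λ _ → 0)))

  sum-zero : ∀ K (f : Fin K → ℕ) → (∀ x → f x ≡ 0) → sum f ≡ 0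
  sum-zero K f e = trans (sum-cong-≗ e) (sum-replicate-zero K)

  ∑-comm-sumWords : ∀ N L K (h : Fin K → List (Fin N) → ℕ) →
                    ∑[ p < K ] sumWords N L (h p) ≡ sumWords N L (λ w → ∑[ p < K ] h p w)
  ∑-comm-sumWords N zero K h = refl
  ∑-comm-sumWords N (suc L) K h =
    trans (∑-comm (λ p x → sumWords N L (h p ∘ (x ∷_))))
          (sum-cong-≗ (λ x → ∑-comm-sumWords N L K (λ p → h p ∘ (x ∷_))))

  insertZero : ∀ {N} → ℕ → List (Fin N) → List (Fin (suc N))
  insertZero zero u = Fin.zero ∷ map Fin.suc u
  insertZero (suc p) [] = Fin.zero ∷ []
  insertZero (suc p) (y ∷ u) = Fin.suc y ∷ insertZero p u

  data TwoZeros {N : ℕ} : List (Fin (suc N)) → Set where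
    zero∷ : ∀ {w} → Fin.zero ∈ w → TwoZeros (Fin.zero ∷ w)
    _∷_ : ∀ (x : Fin (suc N)) {w} → TwoZeros w → TwoZeros (x ∷ w)

  sumWords-avoiding-zero : ∀ N L (h : List (Fin (suc N)) → ℕ) → (∀ w → Fin.zero ∈ w → h w ≡ 0) →
                           sumWords (suc N) L h ≡ sumWords N L (h ∘ map Fin.suc)
  sumWords-avoiding-zero N zero h e = refl
  sumWords-avoiding-zero N (suc L) h e =
    cong₂ _+_ (sumWords-zero (suc N) L _ (λ w _ → e (Fin.zero ∷ w) (here refl)))
              (sum-cong-≗ (λ y → sumWords-avoiding-zero N L (h ∘ (Fin.suc y ∷_)) (λ w z∈w → e (Fin.suc y ∷ w) (there z∈w))))

  sumWords-at-most-one-zero :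
    ∀ N L (g : List (Fin (suc N)) → ℕ) → (∀ w → TwoZeros w → g w ≡ 0) →
    sumWords (suc N) (suc L) g ≡
    sumWords N (suc L) (g ∘ map Fin.suc) + ∑[ p < suc L ] sumWords N L (g ∘ insertZero (toℕ p))
  sumWords-at-most-one-zero N zero g e =
    trans (+-comm (g (Fin.zero ∷ [])) b) (cong (b +_) (sym (+-identityʳ (g (Fin.zero ∷ [])))))
    where b = sum (λ y → g (Fin.suc y ∷ []))
  sumWords-at-most-one-zero N (suc L) g e =
    begin
      sumWords (suc N) (suc L) (g ∘ (Fin.zero ∷_)) + sum (λ y → sumWords (suc N) (suc L) (g ∘ (Fin.suc y ∷_)))
    ≡⟨ cong₂ _+_ (sumWords-avoiding-zero N (suc L) (g ∘ (Fin.zero ∷_)) (λ w z∈w → e (Fin.zero ∷ w) (zero∷ z∈w)))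
                 (sum-cong-≗ (λ y → sumWords-at-most-one-zero N L (g ∘ (Fin.suc y ∷_)) (λ w t → e (Fin.suc y ∷ w) (Fin.suc y ∷ t)))) ⟩
      A + sum (λ y → B y + sum (C y))
    ≡⟨ cong (A +_) (trans (∑-distrib-+ B _) (cong (sum B +_) (∑-comm C))) ⟩
      A + (sum B + sum (λ p → sum (λ y → C y p)))
    ≡⟨ x+[y+z]≡y+[x+z] A (sum B) _ ⟩
      sum B + (A + sum (λ p → sum (λ y → C y p)))
    ∎
    where
      open ≡-Reasoning
      A : ℕ
      A = sumWords N (suc L) (g ∘ insertZero 0)
      B : Fin N → ℕ
      B y = sumWords N (suc L) (g ∘ (Fin.suc y ∷_) ∘ map Fin.suc)
      C : Fin N → Fin (suc L) → ℕ
      C y p = sumWords N L (g ∘ (Fin.suc y ∷_) ∘ insertZero (toℕ p))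
      x+[y+z]≡y+[x+z] : ∀ x y z → x + (y + z) ≡ y + (x + z)
      x+[y+z]≡y+[x+z] = solve 3 (λ x y z → x :+ (y :+ z) := y :+ (x :+ z)) refl

  insertZero-↭ : ∀ {N} p (u : List (Fin N)) → insertZero p u ↭ Fin.zero ∷ map Fin.suc u
  insertZero-↭ zero u = ↭-refl
  insertZero-↭ (suc p) [] = ↭-refl
  insertZero-↭ (suc p) (y ∷ u) = ↭-trans (↭-prep (Fin.suc y) (insertZero-↭ p u)) (↭-swap (Fin.suc y) Fin.zero ↭-refl)

  Unique-resp-↭ : ∀ {A : Set} {xs ys : List A} → xs ↭ ys → Unique xs → Unique ys
  Unique-resp-↭ {A} p = Permₛ.Unique-resp-↭ (↭⇒↭ₛ p)
    where module Permₛ = Data.List.Relation.Binary.Permutation.Setoid.Properties (setoid A)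

  Unique-zero∷map-suc : ∀ {N} {u : List (Fin N)} → Unique u → Unique (Fin.zero ∷ map Fin.suc u)
  Unique-zero∷map-suc {u = u} u! = Allₚ.map⁺ (All.universal (λ _ ()) u) ∷ Uniqueₚ.map⁺ Finₚ.suc-injective u!

  Unique-insertZero : ∀ {N} p (u : List (Fin N)) → Unique u ⇔ Unique (insertZero p u)
  Unique-insertZero p u = mk⇔ (Unique-resp-↭ (↭-sym (insertZero-↭ p u)) ∘ Unique-zero∷map-suc)
                              (λ u! → Uniqueₚ.map⁻ (Unique.tail (Unique-resp-↭ (insertZero-↭ p u) u!)))

  ¬Unique-TwoZeros : ∀ {N} {w : List (Fin (suc N))} → TwoZeros w → ¬ Unique w
  ¬Unique-TwoZeros (zero∷ z∈w) (z∉w ∷ _) = All¬⇒¬Any z∉w z∈w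
  ¬Unique-TwoZeros (_ ∷ t) (_ ∷ w!) = ¬Unique-TwoZeros t w!

  descentsAfter : ∀ {N} → Fin N → List (Fin N) → ℕ
  descentsAfter x [] = 0
  descentsAfter x (y ∷ w) = 𝟙 (y Fin.<? x) + descentsAfter y w

  des-∷ : ∀ {N} (x : Fin N) w → des (x ∷ w) ≡ descentsAfter x w
  des-∷ x [] = refl
  des-∷ x (y ∷ w) with y Fin.<? x
  ... | yes y<x = cong₂ _+_ (sym (𝟙-yes (y Fin.<? x) y<x)) (des-∷ y w)
  ... | no y≮x = cong₂ _+_ (sym (𝟙-no (y Fin.<? x) y≮x)) (des-∷ y w)

  descentsAfter-map-suc : ∀ {N} (x : Fin N) w → descentsAfter (Fin.suc x) (map Fin.suc w) ≡ descentsAfter x w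
  descentsAfter-map-suc x [] = refl
  descentsAfter-map-suc x (y ∷ w) = cong (𝟙 (y Fin.<? x) +_) (descentsAfter-map-suc y w)

  des-map-suc : ∀ {N} (w : List (Fin N)) → des (map Fin.suc w) ≡ des w
  des-map-suc [] = refl
  des-map-suc (x ∷ w) = trans (des-∷ (Fin.suc x) (map Fin.suc w))
                              (trans (descentsAfter-map-suc x w) (sym (des-∷ x w)))

  descentsAfter≤length : ∀ {N} (x : Fin N) w → descentsAfter x w ≤ List.length w
  descentsAfter≤length x [] = z≤n
  descentsAfter≤length x (y ∷ w) = +-mono-≤ (𝟙≤1 (y Fin.<? x)) (descentsAfter≤length y w)

  des-∷≤length : ∀ {N} (x : Fin N) w → des (x ∷ w) ≤ List.length w
  des-∷≤length x w = ≤-trans (≤-reflexive (des-∷ x w)) (descentsAfter≤length x w)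

  des≤length : ∀ {N} (w : List (Fin N)) → des w ≤ List.length w
  des≤length [] = z≤n
  des≤length (x ∷ w) = m≤n⇒m≤1+n (des-∷≤length x w)

  -- Inserting the new minimum into a gap that is a descent keeps the descent
  -- number, into any other gap raises it by one.
  descentsAfter-insertZero :
    ∀ (F : ℕ → ℕ) {N} (y : Fin N) u → let d = descentsAfter y u in
    ∑[ q < suc (List.length u) ] F (descentsAfter (Fin.suc y) (insertZero (toℕ q) u))
      ≡ d * F d + (suc (List.length u) ∸ d) * F (suc d)
  descentsAfter-insertZero F y [] = refl
  descentsAfter-insertZero F y (z ∷ u) =
    begin
      F (suc (descentsAfter (Fin.suc z) (map Fin.suc u)))
        + sum {suc (List.length u)} (λ q → F (c + descentsAfter (Fin.suc z) (insertZero (toℕ q) u)))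
    ≡⟨ cong₂ _+_ (cong (F ∘ suc) (descentsAfter-map-suc z u)) (descentsAfter-insertZero (F ∘ (c +_)) z u) ⟩
      F (suc d) + (d * F (c + d) + (suc (List.length u) ∸ d) * F (c + suc d))
    ≡⟨ step c (𝟙≤1 (z Fin.<? y)) (m≤n⇒m≤1+n (descentsAfter≤length z u)) ⟩
      (c + d) * F (c + d) + (suc (suc (List.length u)) ∸ (c + d)) * F (suc (c + d))
    ∎
    where
      open ≡-Reasoning
      c = 𝟙 (z Fin.<? y)
      d = descentsAfter z u
      step : ∀ c → c ≤ 1 → d ≤ suc (List.length u) →
             F (suc d) + (d * F (c + d) + (suc (List.length u) ∸ d) * F (c + suc d))
               ≡ (c + d) * F (c + d) + (suc (suc (List.length u)) ∸ (c + d)) * F (suc (c + d))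
      step zero _ d≤ = trans (solve 4 (λ a b e f → a :+ (b :* e :+ f :* a) := b :* e :+ (con 1 :+ f) :* a) refl
                                     (F (suc d)) d (F d) (suc (List.length u) ∸ d))
                             (cong (λ t → d * F d + t * F (suc d)) (sym (+-∸-assoc 1 d≤)))
      step (suc zero) _ _ = sym (+-assoc (F (suc d)) (d * F (suc d)) _)
      step (suc (suc _)) (s≤s ()) _

  des-insertZero : ∀ (F : ℕ → ℕ) {N} (u : List (Fin N)) → let d = des u in
    ∑[ p < suc (List.length u) ] F (des (insertZero (toℕ p) u))
      ≡ suc d * F d + (List.length u ∸ d) * F (suc d)
  des-insertZero F [] = sym (+-identityʳ (F 0 + 0))
  des-insertZero F (y ∷ u) =
    begin
      F (des (Fin.zero ∷ Fin.suc y ∷ map Fin.suc u)) + sum {suc (List.length u)} (λ p → F (des (Fin.suc y ∷ insertZero (toℕ p) u)))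
    ≡⟨ cong₂ _+_ (cong F (trans (des-∷ Fin.zero (Fin.suc y ∷ map Fin.suc u)) (descentsAfter-map-suc y u)))
                 (sum-cong-≗ {n = suc (List.length u)} (λ p → cong F (des-∷ (Fin.suc y) (insertZero (toℕ p) u)))) ⟩
      F d + sum {suc (List.length u)} (λ p → F (descentsAfter (Fin.suc y) (insertZero (toℕ p) u)))
    ≡⟨ cong (F d +_) (descentsAfter-insertZero F y u) ⟩
      F d + (d * F d + (suc (List.length u) ∸ d) * F (suc d))
    ≡⟨ sym (+-assoc (F d) (d * F d) _) ⟩
      suc d * F d + (suc (List.length u) ∸ d) * F (suc d)
    ≡⟨ cong (λ t → suc t * F t + (suc (List.length u) ∸ t) * F (suc t)) (sym (des-∷ y u)) ⟩
      suc (des (y ∷ u)) * F (des (y ∷ u)) + (suc (List.length u) ∸ des (y ∷ u)) * F (suc (des (y ∷ u)))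
    ∎
    where
      open ≡-Reasoning
      d = descentsAfter y u

  descentSum : ∀ N L → (ℕ → ℕ) → ℕ
  descentSum N L F = sumWords N L (λ w → 𝟙 (unique? w) * F (des w))

  descentSum-insertZero :
    ∀ N L F → descentSum (suc N) (suc L) F
                ≡ descentSum N (suc L) F + descentSum N L (λ d → suc d * F d + (L ∸ d) * F (suc d))
  descentSum-insertZero N L F =
    begin
      sumWords (suc N) (suc L) g
    ≡⟨ sumWords-at-most-one-zero N L g (λ w t → cong (_* F (des w)) (𝟙-no (unique? w) (¬Unique-TwoZeros t))) ⟩
      sumWords N (suc L) (g ∘ map Fin.suc) + ∑[ p < suc L ] sumWords N L (g ∘ insertZero (toℕ p))
    ≡⟨ cong₂ _+_ (sumWords-cong N (suc L) (λ u _ → lift u))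
                 (trans (∑-comm-sumWords N L (suc L) (λ p → g ∘ insertZero (toℕ p)))
                        (sumWords-cong N L insert)) ⟩
      descentSum N (suc L) F + descentSum N L (λ d → suc d * F d + (L ∸ d) * F (suc d))
    ∎
    where
      open ≡-Reasoning
      g : List (Fin (suc N)) → ℕ
      g w = 𝟙 (unique? w) * F (des w)
      lift : ∀ u → g (map Fin.suc u) ≡ 𝟙 (unique? u) * F (des u)
      lift u = cong₂ _*_ (𝟙-cong Uniqueₚ.map⁻ (Uniqueₚ.map⁺ Finₚ.suc-injective) (unique? (map Fin.suc u)) (unique? u))
                         (cong F (des-map-suc u))
      insert : ∀ u → List.length u ≡ L →
               ∑[ p < suc L ] g (insertZero (toℕ p) u) ≡ 𝟙 (unique? u) * (suc (des u) * F (des u) + (L ∸ des u) * F (suc (des u)))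
      insert u refl =
        begin
          ∑[ p < suc (List.length u) ] g (insertZero (toℕ p) u)
        ≡⟨ sum-cong-≗ {n = suc (List.length u)} (λ p → cong (_* F (des (insertZero (toℕ p) u)))
             (𝟙-cong (Equivalence.from (Unique-insertZero (toℕ p) u)) (Equivalence.to (Unique-insertZero (toℕ p) u)) (unique? _) (unique? u))) ⟩
          ∑[ p < suc (List.length u) ] (𝟙 (unique? u) * F (des (insertZero (toℕ p) u)))
        ≡⟨ sym (*-distribˡ-sum {suc (List.length u)} (𝟙 (unique? u)) (λ p → F (des (insertZero (toℕ p) u)))) ⟩
          𝟙 (unique? u) * ∑[ p < suc (List.length u) ] F (des (insertZero (toℕ p) u))
        ≡⟨ cong (𝟙 (unique? u) *_) (des-insertZero F u) ⟩
          𝟙 (unique? u) * (suc (des u) * F (des u) + (List.length u ∸ des u) * F (suc (des u)))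
        ∎

  descentSum-pigeonhole : ∀ N L F → N < L → descentSum N L F ≡ 0
  descentSum-pigeonhole zero (suc L) F _ = refl
  descentSum-pigeonhole (suc N) (suc L) F (s≤s N<L) =
    trans (descentSum-insertZero N L F)
          (cong₂ _+_ (descentSum-pigeonhole N (suc L) F (m<n⇒m<1+n N<L)) (descentSum-pigeonhole N L (λ d → suc d * F d + (L ∸ d) * F (suc d)) N<L))

  descentSum-cong : ∀ N L {F G : ℕ → ℕ} → (∀ d → d ≤ L → F d ≡ G d) → descentSum N L F ≡ descentSum N L G
  descentSum-cong N L e = sumWords-cong N L (λ w ∣w∣≡L → cong (𝟙 (unique? w) *_) (e (des w) (subst (des w ≤_) ∣w∣≡L (des≤length w))))

  *-distribˡ-descentSum : ∀ N L c F → c * descentSum N L F ≡ descentSum N L (λ d → c * F d)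
  *-distribˡ-descentSum N L c F =
    trans (*-distribˡ-sumWords N L c _)
          (sumWords-cong N L (λ w _ → solve 3 (λ c u f → c :* (u :* f) := u :* (c :* f)) refl c (𝟙 (unique? w)) (F (des w))))

  pascal : ∀ n k → suc n C suc k ≡ n C k + n C suc k
  pascal n k = sym (nCk+nC[k+1]≡[n+1]C[k+1] n k)

  binomial-absorption : ∀ n k → suc k * (suc n C suc k) ≡ suc n * (n C k)
  binomial-absorption zero zero = refl
  binomial-absorption zero (suc k) = *-zeroʳ (suc (suc k))
  binomial-absorption (suc n) zero = trans (+-identityʳ (suc (suc n) C 1)) (trans (nC1≡n (suc (suc n))) (sym (*-identityʳ (suc (suc n)))))
  binomial-absorption (suc n) (suc k) =
    begin
      suc (suc k) * (suc (suc n) C suc (suc k))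
    ≡⟨ cong (suc (suc k) *_) (pascal (suc n) (suc k)) ⟩
      suc (suc k) * (suc n C suc k + suc n C suc (suc k))
    ≡⟨ *-distribˡ-+ (suc (suc k)) (suc n C suc k) _ ⟩
      suc (suc k) * (suc n C suc k) + suc (suc k) * (suc n C suc (suc k))
    ≡⟨ cong₂ (λ s t → suc n C suc k + s + t) (binomial-absorption n k) (binomial-absorption n (suc k)) ⟩
      suc n C suc k + suc n * (n C k) + suc n * (n C suc k)
    ≡⟨ solve 4 (λ a b c e → a :+ b :* c :+ b :* e := a :+ b :* (c :+ e)) refl (suc n C suc k) (suc n) (n C k) (n C suc k) ⟩
      suc n C suc k + suc n * (n C k + n C suc k)
    ≡⟨ cong (λ t → suc n C suc k + suc n * t) (sym (pascal n k)) ⟩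
      suc (suc n) * (suc n C suc k)
    ∎
    where open ≡-Reasoning

  binomial-absorption′ : ∀ n k → suc k * (n C suc k) ≡ (n ∸ k) * (n C k)
  binomial-absorption′ n k =
    begin
      suc k * (n C suc k)
    ≡⟨ sym (m+n∸m≡n (suc k * (n C k)) _) ⟩
      suc k * (n C k) + suc k * (n C suc k) ∸ suc k * (n C k)
    ≡⟨ cong (_∸ suc k * (n C k)) (trans (sym (*-distribˡ-+ (suc k) (n C k) _))
                                        (trans (cong (suc k *_) (sym (pascal n k))) (binomial-absorption n k))) ⟩
      suc n * (n C k) ∸ suc k * (n C k)
    ≡⟨ sym (*-distribʳ-∸ (n C k) (suc n) (suc k)) ⟩
      (n ∸ k) * (n C k)
    ∎
    where open ≡-Reasoning

  worpitzky-step : ∀ m d j → suc m * ((j + m) C (d + j))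
                              ≡ suc d * (suc (j + m) C suc (d + j)) + j * ((j + m) C suc (d + j))
  worpitzky-step m d j = sym (
    begin
      suc d * (suc (j + m) C suc (d + j)) + j * C₁
    ≡⟨ cong (λ t → suc d * t + j * C₁) (pascal (j + m) (d + j)) ⟩
      suc d * (C₀ + C₁) + j * C₁
    ≡⟨ solve 4 (λ a b c e → a :* (b :+ c) :+ e :* c := a :* b :+ (a :+ e) :* c) refl (suc d) C₀ C₁ j ⟩
      suc d * C₀ + suc (d + j) * C₁
    ≡⟨ cong (suc d * C₀ +_) (binomial-absorption′ (j + m) (d + j)) ⟩
      suc d * C₀ + (j + m ∸ (d + j)) * C₀
    ≡⟨ cong (λ t → suc d * C₀ + (j + m ∸ t) * C₀) (+-comm d j) ⟩
      suc d * C₀ + (j + m ∸ (j + d)) * C₀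
    ≡⟨ cong (λ t → suc d * C₀ + t * C₀) ([m+n]∸[m+o]≡n∸o j m d) ⟩
      suc d * C₀ + (m ∸ d) * C₀
    ≡⟨ collect (d ≤? m) ⟩
      suc m * C₀
    ∎)
    where
      open ≡-Reasoning
      C₀ = (j + m) C (d + j)
      C₁ = (j + m) C suc (d + j)
      collect : Dec (d ≤ m) → suc d * C₀ + (m ∸ d) * C₀ ≡ suc m * C₀
      collect (yes d≤m) = trans (sym (*-distribʳ-+ C₀ (suc d) (m ∸ d))) (cong (λ t → suc t * C₀) (m+[n∸m]≡n d≤m))
      collect (no d≰m) rewrite k>n⇒nCk≡0 (subst (_< d + j) (+-comm m j) (+-monoˡ-< j (≰⇒> d≰m)))
        = trans (cong₂ _+_ (*-zeroʳ (suc d)) (*-zeroʳ (m ∸ d))) (sym (*-zeroʳ (suc m)))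

  worpitzky-step′ : ∀ m n d → d ≤ n →
    suc m * ((n + m ∸ d) C n) ≡ suc d * ((suc n + m ∸ d) C suc n) + (n ∸ d) * ((n + m ∸ d) C suc n)
  worpitzky-step′ m n d d≤n with m≤n⇒∃[o]m+o≡n d≤n
  ... | j , refl =
    trans (cong (λ t → suc m * (t C (d + j))) d+j+m∸d)
          (trans (worpitzky-step m d j)
                 (cong₂ _+_ (cong (λ t → suc d * (t C suc (d + j))) (sym suc[d+j+m]∸d))
                            (cong₂ (λ s t → s * (t C suc (d + j))) (sym (m+n∸m≡n d j)) (sym d+j+m∸d))))
    where
      d+j+m∸d : d + j + m ∸ d ≡ j + m
      d+j+m∸d = trans (cong (_∸ d) (+-assoc d j m)) (m+n∸m≡n d (j + m))
      suc[d+j+m]∸d : suc (d + j + m) ∸ d ≡ suc (j + m)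
      suc[d+j+m]∸d = trans (cong (_∸ d) (trans (cong suc (+-assoc d j m)) (sym (+-suc d (j + m))))) (m+n∸m≡n d (suc (j + m)))

  worpitzky : ∀ n m → suc m ^ n ≡ descentSum n n (λ d → (n + m ∸ d) C n)
  worpitzky zero m = refl
  worpitzky (suc n) m =
    begin
      suc m * suc m ^ n
    ≡⟨ cong (suc m *_) (worpitzky n m) ⟩
      suc m * descentSum n n (λ d → (n + m ∸ d) C n)
    ≡⟨ *-distribˡ-descentSum n n (suc m) (λ d → (n + m ∸ d) C n) ⟩
      descentSum n n (λ d → suc m * ((n + m ∸ d) C n))
    ≡⟨ descentSum-cong n n (worpitzky-step′ m n) ⟩
      descentSum n n (λ d → suc d * G d + (n ∸ d) * G (suc d))
    ≡⟨ cong (_+ descentSum n n (λ d → suc d * G d + (n ∸ d) * G (suc d))) (sym (descentSum-pigeonhole n (suc n) G ≤-refl)) ⟩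
      descentSum n (suc n) G + descentSum n n (λ d → suc d * G d + (n ∸ d) * G (suc d))
    ≡⟨ sym (descentSum-insertZero n n G) ⟩
      descentSum (suc n) (suc n) G
    ∎
    where
      open ≡-Reasoning
      G : ℕ → ℕ
      G d = (suc n + m ∸ d) C suc n

  descentCount : ℕ → ℕ → ℕ → ℕ
  descentCount N L k = descentSum N L (λ d → 𝟙 (d ≟ k))

  ∑-𝟙≟ : ∀ K d (f : ℕ → ℕ) → d < K → ∑[ k < K ] (𝟙 (d ≟ toℕ k) * f (toℕ k)) ≡ f d
  ∑-𝟙≟ (suc K) zero f _ = trans (cong (f 0 + 0 +_) (sum-zero K _ (λ _ → refl))) (trans (+-identityʳ _) (+-identityʳ (f 0)))
  ∑-𝟙≟ (suc K) (suc d) f (s≤s d<K) = ∑-𝟙≟ K d (f ∘ suc) d<K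

  ∑-𝟙≟-out : ∀ K d (f : ℕ → ℕ) → K ≤ d → ∑[ k < K ] (𝟙 (d ≟ toℕ k) * f (toℕ k)) ≡ 0
  ∑-𝟙≟-out zero d f _ = refl
  ∑-𝟙≟-out (suc K) (suc d) f (s≤s K≤d) = ∑-𝟙≟-out K d (f ∘ suc) K≤d

  descentSum-distrib-∑ : ∀ N L K (f : Fin K → ℕ → ℕ) →
    descentSum N L (λ d → ∑[ k < K ] f k d) ≡ ∑[ k < K ] descentSum N L (f k)
  descentSum-distrib-∑ N L K f =
    trans (sumWords-cong N L (λ w _ → *-distribˡ-sum (𝟙 (unique? w)) (λ k → f k (des w))))
          (sym (∑-comm-sumWords N L K (λ k w → 𝟙 (unique? w) * f k (des w))))

  descentSum-by-descents : ∀ N L F → descentSum N L F ≡ ∑[ k < suc L ] (descentCount N L (toℕ k) * F (toℕ k))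
  descentSum-by-descents N L F =
    begin
      descentSum N L F
    ≡⟨ descentSum-cong N L (λ d d≤L → sym (∑-𝟙≟ (suc L) d F (s≤s d≤L))) ⟩
      descentSum N L (λ d → ∑[ k < suc L ] (𝟙 (d ≟ toℕ k) * F (toℕ k)))
    ≡⟨ descentSum-distrib-∑ N L (suc L) (λ k d → 𝟙 (d ≟ toℕ k) * F (toℕ k)) ⟩
      ∑[ k < suc L ] descentSum N L (λ d → 𝟙 (d ≟ toℕ k) * F (toℕ k))
    ≡⟨ sum-cong-≗ {n = suc L} (λ k → trans (descentSum-cong N L (λ d _ → *-comm (𝟙 (d ≟ toℕ k)) (F (toℕ k))))
                                 (trans (sym (*-distribˡ-descentSum N L (F (toℕ k)) (λ d → 𝟙 (d ≟ toℕ k)))) (*-comm (F (toℕ k)) _))) ⟩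
      ∑[ k < suc L ] (descentCount N L (toℕ k) * F (toℕ k))
    ∎
    where open ≡-Reasoning

  descentCount-vanishes : ∀ N L k → L < k → descentCount N (suc L) k ≡ 0
  descentCount-vanishes N L k L<k = sumWords-zero N (suc L) _ vanish
    where
      vanish : ∀ w → List.length w ≡ suc L → 𝟙 (unique? w) * 𝟙 (des w ≟ k) ≡ 0
      vanish (x ∷ w) refl = trans (cong (𝟙 (unique? (x ∷ w)) *_) (𝟙-no (des (x ∷ w) ≟ k) des≢k)) (*-zeroʳ (𝟙 (unique? (x ∷ w))))
        where
          des≢k : des (x ∷ w) ≢ k
          des≢k refl = <⇒≱ L<k (des-∷≤length x w)

  length-filter-filter : ∀ {A : Set} {p q} {P : A → Set p} {Q : A → Set q} (P? : Decidable P) (Q? : Decidable Q) xs →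
    List.length (List.filter P? (List.filter Q? xs)) ≡ sumList (map (λ x → 𝟙 (Q? x) * 𝟙 (P? x)) xs)
  length-filter-filter P? Q? [] = refl
  length-filter-filter P? Q? (x ∷ xs) with does (Q? x)
  ... | false = length-filter-filter P? Q? xs
  ... | true with does (P? x)
  ...   | false = length-filter-filter P? Q? xs
  ...   | true = cong suc (length-filter-filter P? Q? xs)

  sumList-map-concatMap : ∀ {A B : Set} (h : B → ℕ) (f : A → List B) xs →
    sumList (map h (List.concatMap f xs)) ≡ sumList (map (λ x → sumList (map h (f x))) xs)
  sumList-map-concatMap h f [] = refl
  sumList-map-concatMap h f (x ∷ xs) =
    trans (cong sumList (map-++ h (f x) (List.concatMap f xs)))
          (trans (sumList-++ (map h (f x)) _) (cong (sumList (map h (f x)) +_) (sumList-map-concatMap h f xs)))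

  sumList-tabulate : ∀ K (f : Fin K → ℕ) → sumList (List.tabulate f) ≡ sum f
  sumList-tabulate zero f = refl
  sumList-tabulate (suc K) f = cong (f Fin.zero +_) (sumList-tabulate K (f ∘ Fin.suc))

  sumList-allVecs : ∀ N L (g : List (Fin N) → ℕ) → sumList (map (g ∘ Vec.toList) (allVecs N L)) ≡ sumWords N L g
  sumList-allVecs N zero g = +-identityʳ (g [])
  sumList-allVecs N (suc L) g =
    begin
      sumList (map (g ∘ Vec.toList) (List.concatMap (λ x → map (x Vec.∷_) (allVecs N L)) (List.allFin N)))
    ≡⟨ sumList-map-concatMap (g ∘ Vec.toList) _ (List.allFin N) ⟩
      sumList (map (λ x → sumList (map (g ∘ Vec.toList) (map (x Vec.∷_) (allVecs N L)))) (List.allFin N))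
    ≡⟨ cong sumList (map-tabulate {n = N} (λ x → x) (λ x → sumList (map (g ∘ Vec.toList) (map (x Vec.∷_) (allVecs N L))))) ⟩
      sumList (List.tabulate (λ x → sumList (map (g ∘ Vec.toList) (map (x Vec.∷_) (allVecs N L)))))
    ≡⟨ sumList-tabulate N _ ⟩
      ∑[ x < N ] sumList (map (g ∘ Vec.toList) (map (x Vec.∷_) (allVecs N L)))
    ≡⟨ sum-cong-≗ {n = N} (λ x → trans (cong sumList (sym (map-∘ (allVecs N L)))) (sumList-allVecs N L (g ∘ (x ∷_)))) ⟩
      ∑[ x < N ] sumWords N L (g ∘ (x ∷_))
    ∎
    where open ≡-Reasoning

  eulerian≡descentCount : ∀ n k → eulerian n (suc k) ≡ descentCount n n k
  eulerian≡descentCount n k =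
    trans (length-filter-filter (λ w → des w ≟ k) unique? (map Vec.toList (allVecs n n)))
          (trans (cong sumList (sym (map-∘ (allVecs n n))))
                 (sumList-allVecs n n (λ w → 𝟙 (unique? w) * 𝟙 (des w ≟ k))))

module EulerianGeneratingFunction where

  open import Defs using (Series; _·_; oneSeries; oneMinusX; _^ˢ_; eulerNumerator)
  import Algebra.Properties.Semiring.Sum as SemiringSum
  open import Data.Fin as Fin using (Fin; toℕ)
  import Data.Fin.Properties as Finₚ
  open import Data.Integer as ℤ using (ℤ; +_; _+_; _*_; _-_; -_)
  import Data.Integer.Properties as ℤₚ
  open import Data.Integer.Solver using (module +-*-Solver)
  open import Data.List as List using ([]; _∷_)
  open import Data.Nat as ℕ using (ℕ; zero; suc; _∸_; _≤_; _^_; z≤n; s≤s; _≟_)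
  open import Data.Nat.Combinatorics using (_C_; nCn≡1; k>n⇒nCk≡0; nCk+nC[k+1]≡[n+1]C[k+1])
  import Data.Nat.Properties as ℕₚ
  open import Data.Sum using (inj₁; inj₂)
  open import Function using (_∘_)
  open import Relation.Binary.PropositionalEquality
  open import Relation.Nullary
  open Iverson 0 1 using (𝟙)
  open Worpitzky using (worpitzky; descentSum-by-descents; descentCount; eulerian≡descentCount; descentCount-vanishes; ∑-𝟙≟; ∑-𝟙≟-out)
  open SemiringSum ℤₚ.+-*-semiring
  module ℕΣ = SemiringSum ℕₚ.+-*-semiring
  open +-*-Solver

  ∑-distrib-- : ∀ {K} (f g : Fin K → ℤ) → ∑[ k < K ] (f k - g k) ≡ sum f - sum g
  ∑-distrib-- {zero} f g = refl
  ∑-distrib-- {suc K} f g =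
    trans (cong (_+_ (f Fin.zero - g Fin.zero)) (∑-distrib-- (f ∘ Fin.suc) (g ∘ Fin.suc)))
          (solve 4 (λ a b c d → (a :- b) :+ (c :- d) := (a :+ c) :- (b :+ d)) refl
                 (f Fin.zero) (g Fin.zero) (sum (f ∘ Fin.suc)) (sum (g ∘ Fin.suc)))

  +-∑ : ∀ {K} (f : Fin K → ℕ) → + (ℕΣ.sum f) ≡ ∑[ k < K ] (+ f k)
  +-∑ {zero} f = refl
  +-∑ {suc K} f = trans (ℤₚ.pos-+ (f Fin.zero) (ℕΣ.sum (f ∘ Fin.suc))) (cong (_+_ (+ f Fin.zero)) (+-∑ (f ∘ Fin.suc)))

  foldr-applyUpTo : ∀ (F : ℕ → ℤ) (g : ℕ → ℕ) n →
    List.foldr _+_ (+ 0) (List.map F (List.applyUpTo g n)) ≡ ∑[ j < n ] F (g (toℕ j))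
  foldr-applyUpTo F g zero = refl
  foldr-applyUpTo F g (suc n) = cong (_+_ (F (g 0))) (foldr-applyUpTo F (g ∘ suc) n)

  ·-as-sum : ∀ (p q : Series) d → (p · q) d ≡ ∑[ j < suc d ] (p (toℕ j) * q (d ∸ toℕ j))
  ·-as-sum p q d = foldr-applyUpTo (λ j → p j * q (d ∸ j)) (λ j → j) (suc d)

  ·-congˡ : ∀ {p p′ : Series} q → (∀ j → p j ≡ p′ j) → ∀ d → (p · q) d ≡ (p′ · q) d
  ·-congˡ {p} {p′} q e d =
    trans (·-as-sum p q d) (trans (sum-cong-≗ {n = suc d} (λ j → cong (_* q (d ∸ toℕ j)) (e (toℕ j)))) (sym (·-as-sum p′ q d)))

  Δ : Series → Series
  Δ s zero = s zero
  Δ s (suc m) = s (suc m) - s m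

  Δ^ : ℕ → Series → Series
  Δ^ zero s = s
  Δ^ (suc k) s = Δ (Δ^ k s)

  Δ-cong : ∀ {s t : Series} → (∀ m → s m ≡ t m) → ∀ d → Δ s d ≡ Δ t d
  Δ-cong e zero = e zero
  Δ-cong e (suc d) = cong₂ _-_ (e (suc d)) (e d)

  Δ^-cong : ∀ k {s t : Series} → (∀ m → s m ≡ t m) → ∀ d → Δ^ k s d ≡ Δ^ k t d
  Δ^-cong zero e = e
  Δ^-cong (suc k) e = Δ-cong (Δ^-cong k e)

  Δ^-suc : ∀ k s d → Δ^ (suc k) s d ≡ Δ^ k (Δ s) d
  Δ^-suc zero s d = refl
  Δ^-suc (suc k) s = Δ-cong (Δ^-suc k s)

  oneSeries-·ˡ : ∀ q d → (oneSeries · q) d ≡ q d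
  oneSeries-·ˡ q d =
    trans (·-as-sum oneSeries q d)
          (trans (cong₂ _+_ (ℤₚ.*-identityˡ (q d)) (trans (sum-cong-≗ {n = d} (λ j → ℤₚ.*-zeroˡ (q (d ∸ suc (toℕ j))))) (sum-replicate-zero d)))
                 (ℤₚ.+-identityʳ (q d)))

  oneMinusX-·ˡ : ∀ p d → (oneMinusX · p) d ≡ Δ p d
  oneMinusX-·ˡ p zero = trans (ℤₚ.+-identityʳ _) (ℤₚ.*-identityˡ (p 0))
  oneMinusX-·ˡ p (suc d) =
    trans (·-as-sum oneMinusX p (suc d))
          (cong₂ _+_ (ℤₚ.*-identityˡ (p (suc d)))
                     (trans (cong₂ _+_ (ℤₚ.-1*i≡-i (p d)) (trans (sum-cong-≗ {n = d} (λ j → ℤₚ.*-zeroˡ (p (d ∸ suc (toℕ j))))) (sum-replicate-zero d)))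
                            (ℤₚ.+-identityʳ (- p d))))

  Δ-·ˡ : ∀ p q d → (Δ p · q) d ≡ Δ (p · q) d
  Δ-·ˡ p q zero = refl
  Δ-·ˡ p q (suc d) =
    begin
      (Δ p · q) (suc d)
    ≡⟨ ·-as-sum (Δ p) q (suc d) ⟩
      p 0 * q (suc d) + ∑[ j < suc d ] ((p (suc (toℕ j)) - p (toℕ j)) * q (d ∸ toℕ j))
    ≡⟨ cong (_+_ (p 0 * q (suc d))) (trans (sum-cong-≗ {n = suc d} (λ j → solve 3 (λ a b c → (a :- b) :* c := a :* c :- b :* c) refl
                                                                 (p (suc (toℕ j))) (p (toℕ j)) (q (d ∸ toℕ j))))
                                         (∑-distrib-- {suc d} (λ j → p (suc (toℕ j)) * q (d ∸ toℕ j)) (λ j → p (toℕ j) * q (d ∸ toℕ j)))) ⟩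
      p 0 * q (suc d) + (∑[ j < suc d ] (p (suc (toℕ j)) * q (d ∸ toℕ j)) - ∑[ j < suc d ] (p (toℕ j) * q (d ∸ toℕ j)))
    ≡⟨ solve 3 (λ a b c → a :+ (b :- c) := (a :+ b) :- c) refl (p 0 * q (suc d))
               (∑[ j < suc d ] (p (suc (toℕ j)) * q (d ∸ toℕ j))) (∑[ j < suc d ] (p (toℕ j) * q (d ∸ toℕ j))) ⟩
      ∑[ j < suc (suc d) ] (p (toℕ j) * q (suc d ∸ toℕ j)) - ∑[ j < suc d ] (p (toℕ j) * q (d ∸ toℕ j))
    ≡⟨ sym (cong₂ _-_ (·-as-sum p q (suc d)) (·-as-sum p q d)) ⟩
      Δ (p · q) (suc d)
    ∎
    where open ≡-Reasoning

  oneMinusX^-·≡Δ^ : ∀ k s d → ((oneMinusX ^ˢ k) · s) d ≡ Δ^ k s d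
  oneMinusX^-·≡Δ^ zero s d = oneSeries-·ˡ s d
  oneMinusX^-·≡Δ^ (suc k) s d =
    begin
      ((oneMinusX · (oneMinusX ^ˢ k)) · s) d
    ≡⟨ ·-congˡ s (oneMinusX-·ˡ (oneMinusX ^ˢ k)) d ⟩
      (Δ (oneMinusX ^ˢ k) · s) d
    ≡⟨ Δ-·ˡ (oneMinusX ^ˢ k) s d ⟩
      Δ ((oneMinusX ^ˢ k) · s) d
    ≡⟨ Δ-cong (oneMinusX^-·≡Δ^ k s) d ⟩
      Δ (Δ^ k s) d
    ∎
    where open ≡-Reasoning

  Δ^-linear : ∀ k K (a : Fin K → ℤ) (t : Fin K → Series) (s : Series) →
    (∀ m → s m ≡ ∑[ i < K ] (a i * t i m)) → ∀ d → Δ^ k s d ≡ ∑[ i < K ] (a i * Δ^ k (t i) d)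
  Δ^-linear zero K a t s e d = e d
  Δ^-linear (suc k) K a t s e zero = Δ^-linear k K a t s e zero
  Δ^-linear (suc k) K a t s e (suc d) =
    trans (cong₂ _-_ (Δ^-linear k K a t s e (suc d)) (Δ^-linear k K a t s e d))
          (trans (sym (∑-distrib-- (λ i → a i * Δ^ k (t i) (suc d)) (λ i → a i * Δ^ k (t i) d)))
                 (sum-cong-≗ {n = K} (λ i → solve 3 (λ a x y → a :* x :- a :* y := a :* (x :- y)) refl
                                        (a i) (Δ^ k (t i) (suc d)) (Δ^ k (t i) d))))

  shift : ℕ → Series → Series
  shift zero s m = s m
  shift (suc k) s zero = + 0
  shift (suc k) s (suc m) = shift k s m

  Δ-shift : ∀ k s d → Δ (shift k s) d ≡ shift k (Δ s) d
  Δ-shift zero s d = refl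
  Δ-shift (suc k) s zero = refl
  Δ-shift (suc k) s (suc zero) = trans (ℤₚ.+-identityʳ (shift k s 0)) (Δ-shift k s zero)
  Δ-shift (suc k) s (suc (suc d)) = Δ-shift k s (suc d)

  Δ^-shift : ∀ n k s d → Δ^ n (shift k s) d ≡ shift k (Δ^ n s) d
  Δ^-shift zero k s d = refl
  Δ^-shift (suc n) k s d = trans (Δ-cong (Δ^-shift n k s) d) (Δ-shift k (Δ^ n s) d)

  shift-oneSeries : ∀ k d → shift k oneSeries d ≡ + 𝟙 (d ≟ k)
  shift-oneSeries zero zero = refl
  shift-oneSeries zero (suc d) = refl
  shift-oneSeries (suc k) zero = refl
  shift-oneSeries (suc k) (suc d) = shift-oneSeries k d

  -- The coefficients of (1 − x)^-(p+1).
  binomialSeries : ℕ → Series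
  binomialSeries p m = + ((m ℕ.+ p) C p)

  Δ-binomialSeries : ∀ p m → Δ (binomialSeries (suc p)) m ≡ binomialSeries p m
  Δ-binomialSeries p zero = cong +_ (trans (nCn≡1 (suc p)) (sym (nCn≡1 p)))
  Δ-binomialSeries p (suc m) =
    begin
      + (suc (m ℕ.+ suc p) C suc p) - + ((m ℕ.+ suc p) C suc p)
    ≡⟨ cong (λ t → + t - + ((m ℕ.+ suc p) C suc p)) (sym (nCk+nC[k+1]≡[n+1]C[k+1] (m ℕ.+ suc p) p)) ⟩
      + ((m ℕ.+ suc p) C p ℕ.+ (m ℕ.+ suc p) C suc p) - + ((m ℕ.+ suc p) C suc p)
    ≡⟨ cong (_- + ((m ℕ.+ suc p) C suc p)) (ℤₚ.pos-+ ((m ℕ.+ suc p) C p) _) ⟩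
      + ((m ℕ.+ suc p) C p) + + ((m ℕ.+ suc p) C suc p) - + ((m ℕ.+ suc p) C suc p)
    ≡⟨ solve 2 (λ a b → a :+ b :- b := a) refl (+ ((m ℕ.+ suc p) C p)) (+ ((m ℕ.+ suc p) C suc p)) ⟩
      + ((m ℕ.+ suc p) C p)
    ≡⟨ cong (λ t → + (t C p)) (ℕₚ.+-suc m p) ⟩
      + (suc (m ℕ.+ p) C p)
    ∎
    where open ≡-Reasoning

  Δ^-binomialSeries : ∀ p m → Δ^ (suc p) (binomialSeries p) m ≡ oneSeries m
  Δ^-binomialSeries zero zero = refl
  Δ^-binomialSeries zero (suc m) = refl
  Δ^-binomialSeries (suc p) m =
    trans (Δ-cong (Δ^-suc p (binomialSeries (suc p))) m)
          (trans (Δ-cong (Δ^-cong p (Δ-binomialSeries p)) m) (Δ^-binomialSeries p m))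

  shift-binomialSeries : ∀ n k m → k ≤ n → + ((n ℕ.+ m ∸ k) C n) ≡ shift k (binomialSeries n) m
  shift-binomialSeries n zero m _ = cong (λ t → + (t C n)) (ℕₚ.+-comm n m)
  shift-binomialSeries n (suc k) zero k<n =
    cong +_ (k>n⇒nCk≡0 (ℕₚ.≤-trans (s≤s (ℕₚ.≤-reflexive (cong (_∸ suc k) (ℕₚ.+-identityʳ n)))) (ℕₚ.∸-monoʳ-< (s≤s z≤n) k<n)))
  shift-binomialSeries n (suc k) (suc m) k<n =
    trans (cong (λ t → + ((t ∸ suc k) C n)) (ℕₚ.+-suc n m)) (shift-binomialSeries n k m (ℕₚ.<⇒≤ k<n))

  shift-cong : ∀ k {s t : Series} → (∀ m → s m ≡ t m) → ∀ d → shift k s d ≡ shift k t d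
  shift-cong zero e d = e d
  shift-cong (suc k) e zero = refl
  shift-cong (suc k) e (suc d) = shift-cong k e d

  powers-by-descents : ∀ n m →
    + (suc m ^ n) ≡ ∑[ k < suc n ] (+ descentCount n n (toℕ k) * shift (toℕ k) (binomialSeries n) m)
  powers-by-descents n m =
    begin
      + (suc m ^ n)
    ≡⟨ cong +_ (trans (worpitzky n m) (descentSum-by-descents n n (λ d → (n ℕ.+ m ∸ d) C n))) ⟩
      + (ℕΣ.∑[ k < suc n ] (descentCount n n (toℕ k) ℕ.* ((n ℕ.+ m ∸ toℕ k) C n)))
    ≡⟨ +-∑ {suc n} (λ k → descentCount n n (toℕ k) ℕ.* ((n ℕ.+ m ∸ toℕ k) C n)) ⟩
      ∑[ k < suc n ] (+ (descentCount n n (toℕ k) ℕ.* ((n ℕ.+ m ∸ toℕ k) C n)))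
    ≡⟨ sum-cong-≗ {n = suc n} (λ k → trans (ℤₚ.pos-* (descentCount n n (toℕ k)) ((n ℕ.+ m ∸ toℕ k) C n))
                                   (cong (+ descentCount n n (toℕ k) *_)
                                         (shift-binomialSeries n (toℕ k) m (ℕₚ.≤-pred (Finₚ.toℕ<n k))))) ⟩
      ∑[ k < suc n ] (+ descentCount n n (toℕ k) * shift (toℕ k) (binomialSeries n) m)
    ∎
    where open ≡-Reasoning

  ∑-descentCount-𝟙 : ∀ n d →
    ∑[ k < suc n ] (+ descentCount n n (toℕ k) * + 𝟙 (d ≟ toℕ k))
      ≡ + (ℕΣ.∑[ k < suc n ] (𝟙 (d ≟ toℕ k) ℕ.* descentCount n n (toℕ k)))
  ∑-descentCount-𝟙 n d =
    trans (sum-cong-≗ {n = suc n} (λ k → trans (sym (ℤₚ.pos-* (descentCount n n (toℕ k)) (𝟙 (d ≟ toℕ k))))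
                                        (cong +_ (ℕₚ.*-comm (descentCount n n (toℕ k)) (𝟙 (d ≟ toℕ k))))))
          (sym (+-∑ {suc n} (λ k → 𝟙 (d ≟ toℕ k) ℕ.* descentCount n n (toℕ k))))

  eulerNumerator-by-descents : ∀ n′ d → let n = suc n′ in
    ∑[ k < suc n ] (+ descentCount n n (toℕ k) * + 𝟙 (d ≟ toℕ k)) ≡ eulerNumerator n d
  eulerNumerator-by-descents n′ d with d ℕ.<? suc n′
  ... | yes d<n = trans (∑-descentCount-𝟙 (suc n′) d)
                        (cong +_ (trans (∑-𝟙≟ (suc (suc n′)) d (descentCount (suc n′) (suc n′)) (ℕₚ.m<n⇒m<1+n d<n)) (sym (eulerian≡descentCount (suc n′) d))))
  ... | no d≮n with ℕₚ.m≤n⇒m<n∨m≡n (ℕₚ.≮⇒≥ d≮n)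
  ...   | inj₁ n<d = trans (∑-descentCount-𝟙 (suc n′) d) (cong +_ (∑-𝟙≟-out (suc (suc n′)) d (descentCount (suc n′) (suc n′)) n<d))
  ...   | inj₂ refl = trans (∑-descentCount-𝟙 (suc n′) d)
                            (cong +_ (trans (∑-𝟙≟ (suc (suc n′)) d (descentCount (suc n′) (suc n′)) ℕₚ.≤-refl) (descentCount-vanishes (suc n′) n′ (suc n′) ℕₚ.≤-refl)))

  eulerian-series : ∀ n′ d → let n = suc n′ in
    ((oneMinusX ^ˢ suc n) · (λ m → + (suc m ^ n))) d ≡ eulerNumerator n d
  eulerian-series n′ d =
    begin
      ((oneMinusX ^ˢ suc n) · (λ m → + (suc m ^ n))) d
    ≡⟨ oneMinusX^-·≡Δ^ (suc n) _ d ⟩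
      Δ^ (suc n) (λ m → + (suc m ^ n)) d
    ≡⟨ Δ^-linear (suc n) (suc n) a t _ (powers-by-descents n) d ⟩
      ∑[ k < suc n ] (a k * Δ^ (suc n) (t k) d)
    ≡⟨ sum-cong-≗ {n = suc n} (λ k → cong (a k *_) (trans (Δ^-shift (suc n) (toℕ k) (binomialSeries n) d)
                                                 (trans (shift-cong (toℕ k) (Δ^-binomialSeries n) d) (shift-oneSeries (toℕ k) d)))) ⟩
      ∑[ k < suc n ] (a k * + 𝟙 (d ≟ toℕ k))
    ≡⟨ eulerNumerator-by-descents n′ d ⟩
      eulerNumerator n d
    ∎
    where
      open ≡-Reasoning
      n = suc n′
      a : Fin (suc n) → ℤ
      a k = + descentCount n n (toℕ k)
      t : Fin (suc n) → Series
      t k = shift (toℕ k) (binomialSeries n)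

module RationalVectors where

  open import Algebra.Bundles using (CommutativeRing)
  import Algebra.Properties.Semiring.Sum as SemiringSum
  open import Data.Fin as Fin using (Fin; inject₁; fromℕ)
  import Data.Fin.Properties as Finₚ
  open import Data.Nat as ℕ using (zero; suc)
  open import Data.Product using (_×_; _,_)
  open import Data.Rational as ℚ using (ℚ; 0ℚ; 1ℚ; _+_; _*_; _-_; -_; _≤_; _<_; 1/_)
  import Data.Rational.Properties as ℚₚ
  open import Data.Rational.Solver using (module +-*-Solver)
  import Data.Vec.Functional as Vector
  open import Function using (_∘_)
  open import Relation.Binary.Definitions using (tri<; tri≈; tri>)
  open import Relation.Binary.PropositionalEquality
  open import Relation.Nullary
  open Iverson 0ℚ 1ℚ using (𝟙)
  open SemiringSum (CommutativeRing.semiring ℚₚ.+-*-commutativeRing)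
  open +-*-Solver

  sum-zero : ∀ K (f : Fin K → ℚ) → (∀ x → f x ≡ 0ℚ) → sum f ≡ 0ℚ
  sum-zero K f e = trans (sum-cong-≗ e) (sum-replicate-zero K)

  ∑-distrib-- : ∀ {K} (f g : Fin K → ℚ) → ∑[ k < K ] (f k - g k) ≡ sum f - sum g
  ∑-distrib-- {zero} f g = refl
  ∑-distrib-- {suc K} f g =
    trans (cong (λ t → (f Fin.zero - g Fin.zero) + t) (∑-distrib-- (f ∘ Fin.suc) (g ∘ Fin.suc)))
          (solve 4 (λ a b c d → (a :- b) :+ (c :- d) := (a :+ c) :- (b :+ d)) refl
                 (f Fin.zero) (g Fin.zero) (sum (f ∘ Fin.suc)) (sum (g ∘ Fin.suc)))

  δ : ∀ {K} → Fin K → Fin K → ℚ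
  δ i j = 𝟙 (i Finₚ.≟ j)

  ∑-δ : ∀ {K} (h : Fin K → ℚ) k → ∑[ k′ < K ] (δ k′ k * h k′) ≡ h k
  ∑-δ {suc K} h Fin.zero =
    trans (cong₂ _+_ (ℚₚ.*-identityˡ (h Fin.zero)) (sum-zero K _ (λ k′ → ℚₚ.*-zeroˡ (h (Fin.suc k′)))))
          (ℚₚ.+-identityʳ (h Fin.zero))
  ∑-δ {suc K} h (Fin.suc k) =
    trans (cong₂ _+_ (ℚₚ.*-zeroˡ (h Fin.zero)) (∑-δ (h ∘ Fin.suc) k)) (ℚₚ.+-identityˡ (h (Fin.suc k)))

  _∷ʳ_ : ∀ {A : Set} {K} → (Fin K → A) → A → Fin (suc K) → A
  _∷ʳ_ {K = zero} g b Fin.zero = b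
  _∷ʳ_ {K = suc K} g b Fin.zero = g Fin.zero
  _∷ʳ_ {K = suc K} g b (Fin.suc i) = ((g ∘ Fin.suc) ∷ʳ b) i

  ∷ʳ-inject₁ : ∀ {A : Set} {K} (g : Fin K → A) b j → (g ∷ʳ b) (inject₁ j) ≡ g j
  ∷ʳ-inject₁ g b Fin.zero = refl
  ∷ʳ-inject₁ g b (Fin.suc j) = ∷ʳ-inject₁ (g ∘ Fin.suc) b j

  ∷ʳ-fromℕ : ∀ {A : Set} K (g : Fin K → A) b → (g ∷ʳ b) (fromℕ K) ≡ b
  ∷ʳ-fromℕ zero g b = refl
  ∷ʳ-fromℕ (suc K) g b = ∷ʳ-fromℕ K (g ∘ Fin.suc) b

  init∷ʳlast : ∀ {A : Set} {K} (h : Fin (suc K) → A) i → ((h ∘ inject₁) ∷ʳ h (fromℕ K)) i ≡ h i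
  init∷ʳlast {K = zero} h Fin.zero = refl
  init∷ʳlast {K = suc K} h Fin.zero = refl
  init∷ʳlast {K = suc K} h (Fin.suc i) = init∷ʳlast (h ∘ Fin.suc) i

  map-∷ʳ : ∀ {A B : Set} {K} (f : A → B) (g : Fin K → A) b i → f ((g ∷ʳ b) i) ≡ ((f ∘ g) ∷ʳ f b) i
  map-∷ʳ {K = zero} f g b Fin.zero = refl
  map-∷ʳ {K = suc K} f g b Fin.zero = refl
  map-∷ʳ {K = suc K} f g b (Fin.suc i) = map-∷ʳ f (g ∘ Fin.suc) b i

  ∷ʳ-cong : ∀ {A : Set} {K} {g h : Fin K → A} b → (∀ j → g j ≡ h j) → ∀ i → (g ∷ʳ b) i ≡ (h ∷ʳ b) i
  ∷ʳ-cong {K = zero} b e Fin.zero = refl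
  ∷ʳ-cong {K = suc K} b e Fin.zero = e Fin.zero
  ∷ʳ-cong {K = suc K} b e (Fin.suc i) = ∷ʳ-cong b (e ∘ Fin.suc) i

  ∷ʳ-all : ∀ {A : Set} {K} (P : A → Set) {g : Fin K → A} {b} → (∀ j → P (g j)) → P b → ∀ i → P ((g ∷ʳ b) i)
  ∷ʳ-all {K = zero} P Pg Pb Fin.zero = Pb
  ∷ʳ-all {K = suc K} P Pg Pb Fin.zero = Pg Fin.zero
  ∷ʳ-all {K = suc K} P Pg Pb (Fin.suc i) = ∷ʳ-all P (Pg ∘ Fin.suc) Pb i

  ∑-δ-∷ʳ : ∀ {K} (g : Fin K → ℚ) b a → ∑[ j < K ] (δ (inject₁ j) a * g j) + δ (fromℕ K) a * b ≡ (g ∷ʳ b) a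
  ∑-δ-∷ʳ {K} g b a =
    begin
      ∑[ j < K ] (δ (inject₁ j) a * g j) + δ (fromℕ K) a * b
    ≡⟨ sym (cong₂ _+_ (sum-cong-≗ (λ j → cong (δ (inject₁ j) a *_) (∷ʳ-inject₁ g b j))) (cong (δ (fromℕ K) a *_) (∷ʳ-fromℕ K g b))) ⟩
      ∑[ j < K ] (δ (inject₁ j) a * (g ∷ʳ b) (inject₁ j)) + δ (fromℕ K) a * (g ∷ʳ b) (fromℕ K)
    ≡⟨ sym (sum-init-last (λ k → δ k a * (g ∷ʳ b) k)) ⟩
      ∑[ k < suc K ] (δ k a * (g ∷ʳ b) k)
    ≡⟨ ∑-δ (g ∷ʳ b) a ⟩
      (g ∷ʳ b) a
    ∎
    where open ≡-Reasoning

  ∑-δ-inject₁ : ∀ {K} (g : Fin K → ℚ) a → ∑[ j < K ] (δ (inject₁ j) a * g j) ≡ (g ∷ʳ 0ℚ) a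
  ∑-δ-inject₁ {K} g a =
    trans (sym (trans (cong (∑[ j < K ] (δ (inject₁ j) a * g j) +_) (ℚₚ.*-zeroʳ (δ (fromℕ K) a)))
                      (ℚₚ.+-identityʳ _)))
          (∑-δ-∷ʳ g 0ℚ a)

  ∑-δ-suc : ∀ {K} (g : Fin K → ℚ) a → ∑[ j < K ] (δ (Fin.suc j) a * g j) ≡ (0ℚ Vector.∷ g) a
  ∑-δ-suc {K} g Fin.zero = sum-zero K _ (λ j → ℚₚ.*-zeroˡ (g j))
  ∑-δ-suc g (Fin.suc a) = ∑-δ g a

  x≤x+y : ∀ x {y} → 0ℚ ≤ y → x ≤ x + y
  x≤x+y x {y} 0≤y = ℚₚ.≤-trans (ℚₚ.≤-reflexive (sym (ℚₚ.+-identityʳ x))) (ℚₚ.+-monoʳ-≤ x 0≤y)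

  0≤x+y : ∀ {x y} → 0ℚ ≤ x → 0ℚ ≤ y → 0ℚ ≤ x + y
  0≤x+y {x} 0≤x 0≤y = ℚₚ.≤-trans 0≤x (x≤x+y x 0≤y)

  0≤x*y : ∀ {x y} → 0ℚ ≤ x → 0ℚ ≤ y → 0ℚ ≤ x * y
  0≤x*y {x} {y} 0≤x 0≤y = ℚₚ.≤-trans (ℚₚ.≤-reflexive (sym (ℚₚ.*-zeroˡ y))) (ℚₚ.*-monoʳ-≤-nonNeg y {{ℚ.nonNegative 0≤y}} 0≤x)

  0<1-t : ∀ {t} → t < 1ℚ → 0ℚ < 1ℚ - t
  0<1-t {t} t<1 = ℚₚ.≤-<-trans (ℚₚ.≤-reflexive (sym (ℚₚ.+-inverseʳ t))) (ℚₚ.+-monoˡ-< (- t) t<1)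

  0≤𝟙 : ∀ {p} {P : Set p} (d : Dec P) → 0ℚ ≤ 𝟙 d
  0≤𝟙 (yes _) = ℚₚ.<⇒≤ (ℚₚ.positive⁻¹ 1ℚ)
  0≤𝟙 (no _) = ℚₚ.≤-refl

  *-cancel-pos : ∀ r {z} → 0ℚ < r → r * z ≡ 0ℚ → z ≡ 0ℚ
  *-cancel-pos r {z} 0<r rz≡0 =
    begin
      z                   ≡⟨ sym (ℚₚ.*-identityˡ z) ⟩
      1ℚ * z              ≡⟨ cong (_* z) (sym (ℚₚ.*-inverseˡ r {{ℚ.>-nonZero 0<r}})) ⟩
      (1/ r) * r * z      ≡⟨ ℚₚ.*-assoc ((1/ r) {{ℚ.>-nonZero 0<r}}) r z ⟩
      (1/ r) * (r * z)    ≡⟨ cong ((1/ r) {{ℚ.>-nonZero 0<r}} *_) rz≡0 ⟩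
      (1/ r) * 0ℚ         ≡⟨ ℚₚ.*-zeroʳ ((1/ r) {{ℚ.>-nonZero 0<r}}) ⟩
      0ℚ                  ∎
    where
      open ≡-Reasoning
      instance _ = ℚ.>-nonZero 0<r

  mix≡0 : ∀ {t x y} → 0ℚ < t → t < 1ℚ → 0ℚ ≤ x → 0ℚ ≤ y → t * x + (1ℚ - t) * y ≡ 0ℚ → x ≡ 0ℚ × y ≡ 0ℚ
  mix≡0 {t} {x} {y} 0<t t<1 0≤x 0≤y e = *-cancel-pos t 0<t tx≡0 , *-cancel-pos (1ℚ - t) (0<1-t t<1) sy≡0
    where
      0≤tx : 0ℚ ≤ t * x
      0≤tx = 0≤x*y (ℚₚ.<⇒≤ 0<t) 0≤x
      0≤sy : 0ℚ ≤ (1ℚ - t) * y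
      0≤sy = 0≤x*y (ℚₚ.<⇒≤ (0<1-t t<1)) 0≤y
      tx≡0 : t * x ≡ 0ℚ
      tx≡0 = ℚₚ.≤-antisym (ℚₚ.≤-trans (x≤x+y (t * x) 0≤sy) (ℚₚ.≤-reflexive e)) 0≤tx
      sy≡0 : (1ℚ - t) * y ≡ 0ℚ
      sy≡0 = ℚₚ.≤-antisym (ℚₚ.≤-trans (ℚₚ.≤-trans (ℚₚ.≤-reflexive (sym (ℚₚ.+-identityˡ _))) (ℚₚ.+-monoˡ-≤ _ 0≤tx))
                                      (ℚₚ.≤-reflexive e)) 0≤sy

  sum-nonneg : ∀ {K} (g : Fin K → ℚ) → (∀ a → 0ℚ ≤ g a) → 0ℚ ≤ sum g
  sum-nonneg {zero} g _ = ℚₚ.≤-refl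
  sum-nonneg {suc K} g 0≤g = 0≤x+y (0≤g Fin.zero) (sum-nonneg (g ∘ Fin.suc) (0≤g ∘ Fin.suc))

  entry≤sum : ∀ {K} (g : Fin K → ℚ) → (∀ a → 0ℚ ≤ g a) → ∀ a → g a ≤ sum g
  entry≤sum {suc K} g 0≤g Fin.zero = x≤x+y (g Fin.zero) (sum-nonneg (g ∘ Fin.suc) (0≤g ∘ Fin.suc))
  entry≤sum {suc K} g 0≤g (Fin.suc a) =
    ℚₚ.≤-trans (entry≤sum (g ∘ Fin.suc) (0≤g ∘ Fin.suc) a)
               (ℚₚ.≤-trans (ℚₚ.≤-reflexive (sym (ℚₚ.+-identityˡ _))) (ℚₚ.+-monoˡ-≤ _ (0≤g Fin.zero)))

  partialSum : ∀ {K} → (Fin (suc K) → ℚ) → Fin (suc K) → ℚ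
  partialSum g Fin.zero = g Fin.zero
  partialSum {suc K} g (Fin.suc b) = g Fin.zero + partialSum (g ∘ Fin.suc) b

  partialSum-suc : ∀ {K} (g : Fin (suc (suc K)) → ℚ) b → partialSum g (Fin.suc b) ≡ partialSum g (inject₁ b) + g (Fin.suc b)
  partialSum-suc g Fin.zero = refl
  partialSum-suc {suc K} g (Fin.suc b) = trans (cong (g Fin.zero +_) (partialSum-suc (g ∘ Fin.suc) b)) (sym (ℚₚ.+-assoc (g Fin.zero) _ _))

  partialSum-last : ∀ K (g : Fin (suc K) → ℚ) → partialSum g (fromℕ K) ≡ sum g
  partialSum-last zero g = sym (ℚₚ.+-identityʳ (g Fin.zero))
  partialSum-last (suc K) g = cong (g Fin.zero +_) (partialSum-last K (g ∘ Fin.suc))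

  partialSum-cong : ∀ {K} {g h : Fin (suc K) → ℚ} → (∀ a → g a ≡ h a) → ∀ b → partialSum g b ≡ partialSum h b
  partialSum-cong e Fin.zero = e Fin.zero
  partialSum-cong {suc K} e (Fin.suc b) = cong₂ _+_ (e Fin.zero) (partialSum-cong (e ∘ Fin.suc) b)

  partialSum-linear : ∀ {K} x y (g h : Fin (suc K) → ℚ) b →
    partialSum (λ a → x * g a + y * h a) b ≡ x * partialSum g b + y * partialSum h b
  partialSum-linear x y g h Fin.zero = refl
  partialSum-linear {suc K} x y g h (Fin.suc b) =
    trans (cong ((x * g Fin.zero + y * h Fin.zero) +_) (partialSum-linear x y (g ∘ Fin.suc) (h ∘ Fin.suc) b))
          (solve 6 (λ x y a b c d → (x :* a :+ y :* b) :+ (x :* c :+ y :* d) := x :* (a :+ c) :+ y :* (b :+ d)) refl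
                 x y (g Fin.zero) (h Fin.zero) (partialSum (g ∘ Fin.suc) b) (partialSum (h ∘ Fin.suc) b))

  partialSum-nonneg : ∀ {K} (g : Fin (suc K) → ℚ) → (∀ a → 0ℚ ≤ g a) → ∀ b → 0ℚ ≤ partialSum g b
  partialSum-nonneg g 0≤g Fin.zero = 0≤g Fin.zero
  partialSum-nonneg {suc K} g 0≤g (Fin.suc b) = 0≤x+y (0≤g Fin.zero) (partialSum-nonneg (g ∘ Fin.suc) (0≤g ∘ Fin.suc) b)

  partialSum≤sum : ∀ {K} (g : Fin (suc K) → ℚ) → (∀ a → 0ℚ ≤ g a) → ∀ b → partialSum g b ≤ sum g
  partialSum≤sum {zero} g 0≤g Fin.zero = ℚₚ.≤-reflexive (sym (ℚₚ.+-identityʳ (g Fin.zero)))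
  partialSum≤sum {suc K} g 0≤g Fin.zero = x≤x+y (g Fin.zero) (sum-nonneg (g ∘ Fin.suc) (0≤g ∘ Fin.suc))
  partialSum≤sum {suc K} g 0≤g (Fin.suc b) = ℚₚ.+-monoʳ-≤ (g Fin.zero) (partialSum≤sum (g ∘ Fin.suc) (0≤g ∘ Fin.suc) b)

  constant-by-steps : ∀ {A : Set} K (h : Fin (suc K) → A) → (∀ j → h (Fin.suc j) ≡ h (inject₁ j)) → ∀ j → h j ≡ h Fin.zero
  constant-by-steps K h step Fin.zero = refl
  constant-by-steps (suc K) h step (Fin.suc j) = trans (step j) (constant-by-steps K (h ∘ inject₁) (step ∘ inject₁) j)

  x-y≡0⇒x≡y : ∀ {x y} → x - y ≡ 0ℚ → x ≡ y
  x-y≡0⇒x≡y {x} {y} = x∙y⁻¹≈ε⇒x≈y x y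
    where open import Algebra.Properties.Group ℚₚ.+-0-group using (x∙y⁻¹≈ε⇒x≈y)

  ≤∧≢⇒< : ∀ {x y : ℚ} → x ≤ y → x ≢ y → x < y
  ≤∧≢⇒< {x} {y} x≤y x≢y with ℚₚ.<-cmp x y
  ... | tri< x<y _ _ = x<y
  ... | tri≈ _ x≡y _ = contradiction x≡y x≢y
  ... | tri> _ _ y<x = contradiction (ℚₚ.≤-<-trans x≤y y<x) (ℚₚ.<-irrefl refl)

module ProductOfSimplices where

  open import Algebra.Bundles using (CommutativeRing)
  import Algebra.Properties.Semiring.Sum as SemiringSum
  open import Data.Fin as Fin using (Fin; punchIn; punchOut)
  import Data.Fin.Properties as Finₚ
  open import Data.Nat as ℕ using (ℕ; suc)
  open import Data.Product using (_×_; _,_; proj₁; proj₂; ∃; ∃₂)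
  open import Data.Rational as ℚ using (ℚ; 0ℚ; 1ℚ; _+_; _*_; _-_; _≤_; _<_; 1/_)
  import Data.Rational.Properties as ℚₚ
  open import Data.Rational.Solver using (module +-*-Solver)
  open import Data.Sum using (_⊎_; inj₁; inj₂)
  open import Data.Vec as Vec using (Vec)
  import Data.Vec.Functional as Vector
  import Data.Vec.Functional.Properties as Vectorₚ
  import Data.Vec.Properties as Vecₚ
  open import Function using (_∘_)
  open import Relation.Binary.PropositionalEquality
  open import Relation.Nullary
  open RationalVectors
  open Iverson 0ℚ 1ℚ using (𝟙-yes; 𝟙-no)
  open SemiringSum (CommutativeRing.semiring ℚₚ.+-*-commutativeRing)
  open +-*-Solver

  record IsDistribution {K} (g : Fin K → ℚ) : Set where
    constructor distribution
    field
      nonneg : ∀ a → 0ℚ ≤ g a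
      sum≡1 : sum g ≡ 1ℚ

  open IsDistribution public

  removeAt-punchOut : ∀ {K} (g : Fin (suc K) → ℚ) {c a} (c≢a : c ≢ a) → Vector.removeAt g c (punchOut c≢a) ≡ g a
  removeAt-punchOut g c≢a = cong g (Finₚ.punchIn-punchOut c≢a)

  distribution-unit : ∀ {K} (g : Fin (suc K) → ℚ) → IsDistribution g → ∀ c → g c ≡ 1ℚ → ∀ a → g a ≡ δ a c
  distribution-unit g (distribution 0≤g ∑g≡1) c gc≡1 a with a Finₚ.≟ c
  ... | yes refl = gc≡1
  ... | no a≢c = ℚₚ.≤-antisym
    (begin
      g a                                          ≡⟨ sym (removeAt-punchOut g (a≢c ∘ sym)) ⟩
      Vector.removeAt g c (punchOut (a≢c ∘ sym))   ≤⟨ entry≤sum (Vector.removeAt g c) (0≤g ∘ punchIn c) _ ⟩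
      sum (Vector.removeAt g c)                    ≡⟨ rest≡0 ⟩
      0ℚ                                           ∎)
    (0≤g a)
    where
      open ℚₚ.≤-Reasoning
      rest≡0 : sum (Vector.removeAt g c) ≡ 0ℚ
      rest≡0 = trans (solve 2 (λ s x → s := (x :+ s) :- x) refl (sum (Vector.removeAt g c)) (g c))
                     (trans (cong (_- g c) (sym (sum-remove g))) (trans (cong₂ _-_ ∑g≡1 gc≡1) (ℚₚ.+-inverseʳ 1ℚ)))

  distribution-concentrated : ∀ {K} (g : Fin (suc K) → ℚ) → sum g ≡ 1ℚ → ∀ c → (∀ a → a ≢ c → g a ≡ 0ℚ) → g c ≡ 1ℚ
  distribution-concentrated g ∑g≡1 c off =
    begin
      g c                               ≡⟨ sym (ℚₚ.+-identityʳ (g c)) ⟩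
      g c + 0ℚ                          ≡⟨ cong (g c +_) (sym (sum-zero _ (Vector.removeAt g c) (λ x → off _ (Finₚ.punchInᵢ≢i c x)))) ⟩
      g c + sum (Vector.removeAt g c)   ≡⟨ sym (sum-remove g) ⟩
      sum g                             ≡⟨ ∑g≡1 ⟩
      1ℚ                                ∎
    where open ≡-Reasoning

  module _ {R K : ℕ} where

    Matrix : Set
    Matrix = Fin R → Fin (suc K) → ℚ

    IsStochastic : Matrix → Set
    IsStochastic d = ∀ i → IsDistribution (d i)

    unitMatrix : Vec (Fin (suc K)) R → Matrix
    unitMatrix c i a = δ a (Vec.lookup c i)

    unitMatrix-stochastic : ∀ c → IsStochastic (unitMatrix c)
    unitMatrix-stochastic c i =
      distribution (λ a → 0≤𝟙 (a Finₚ.≟ Vec.lookup c i))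
      (trans (sum-cong-≗ (λ a → sym (ℚₚ.*-identityʳ (δ a (Vec.lookup c i))))) (∑-δ (λ _ → 1ℚ) (Vec.lookup c i)))

    unitMatrix-extreme : ∀ c p q {t} → IsStochastic p → IsStochastic q → 0ℚ < t → t < 1ℚ →
                         (∀ i a → unitMatrix c i a ≡ t * p i a + (1ℚ - t) * q i a) → ∀ i a → p i a ≡ q i a
    unitMatrix-extreme c p q p-stoch q-stoch 0<t t<1 c≡mix i a with a Finₚ.≟ Vec.lookup c i
    ... | yes refl = trans (distribution-concentrated (p i) (sum≡1 (p-stoch i)) a (λ b b≢a → proj₁ (off b b≢a)))
                           (sym (distribution-concentrated (q i) (sum≡1 (q-stoch i)) a (λ b b≢a → proj₂ (off b b≢a))))
      where
        off : ∀ b → b ≢ a → p i b ≡ 0ℚ × q i b ≡ 0ℚ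
        off b b≢a = mix≡0 0<t t<1 (nonneg (p-stoch i) b) (nonneg (q-stoch i) b)
                          (trans (sym (c≡mix i b)) (𝟙-no (b Finₚ.≟ a) b≢a))
    ... | no a≢cᵢ = trans (proj₁ both≡0) (sym (proj₂ both≡0))
      where
        both≡0 = mix≡0 0<t t<1 (nonneg (p-stoch i) a) (nonneg (q-stoch i) a)
                       (trans (sym (c≡mix i a)) (𝟙-no (a Finₚ.≟ Vec.lookup c i) a≢cᵢ))

    stochastic-unit-or-fractional : ∀ d → IsStochastic d →
      (∃ λ c → ∀ i a → d i a ≡ unitMatrix c i a) ⊎ (∃₂ λ i a → 0ℚ < d i a × d i a < 1ℚ)
    stochastic-unit-or-fractional d d-stoch with Finₚ.all? (λ i → Finₚ.any? (λ a → d i a ℚₚ.≟ 1ℚ))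
    ... | yes hasOne = inj₁ (c , λ i a → trans (distribution-unit (d i) (d-stoch i) (proj₁ (hasOne i)) (proj₂ (hasOne i)) a)
                                               (cong (δ a) (sym (Vecₚ.lookup∘tabulate (proj₁ ∘ hasOne) i))))
      where c = Vec.tabulate (proj₁ ∘ hasOne)
    ... | no ¬hasOne with Finₚ.¬∀⟶∃¬ R _ (λ i → Finₚ.any? (λ a → d i a ℚₚ.≟ 1ℚ)) ¬hasOne
    ...   | i , noOne with Finₚ.any? (λ a → 0ℚ ℚₚ.<? d i a)
    ...     | yes (a , 0<dᵢₐ) = inj₂ (i , a , 0<dᵢₐ , ≤∧≢⇒< (ℚₚ.≤-trans (entry≤sum (d i) (nonneg (d-stoch i)) a) (ℚₚ.≤-reflexive (sum≡1 (d-stoch i))))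
                                                            (λ dᵢₐ≡1 → noOne (a , dᵢₐ≡1)))
    ...     | no ¬pos = contradiction (trans (sym (sum-zero _ (d i) zero-row)) (sum≡1 (d-stoch i))) λ ()
      where
        zero-row : ∀ a → d i a ≡ 0ℚ
        zero-row a = ℚₚ.≤-antisym (ℚₚ.≮⇒≥ (λ 0<dᵢₐ → ¬pos (a , 0<dᵢₐ))) (nonneg (d-stoch i) a)

    record Split (d : Matrix) (i : Fin R) (a : Fin (suc K)) : Set where
      field
        p q : Matrix
        p-stochastic : IsStochastic p
        q-stochastic : IsStochastic q
        decomposition : ∀ i′ a′ → d i′ a′ ≡ d i a * p i′ a′ + (1ℚ - d i a) * q i′ a′
        separated : p i a ≢ q i a

    -- With t = d i a, the row i of p is the unit vector at a and that of q is (d i − t·eₐ)/(1 − t).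
    split-at-fractional : ∀ d → IsStochastic d → ∀ i a → 0ℚ < d i a → d i a < 1ℚ → Split d i a
    split-at-fractional d d-stoch i a 0<t t<1 = record
      { p = p ; q = q ; p-stochastic = p-stoch ; q-stochastic = q-stoch ; decomposition = d≡mix ; separated = p≢q }
      where
        t = d i a
        instance _ = ℚ.>-nonZero (0<1-t t<1)
        u : ℚ
        u = 1/ (1ℚ - t)
        [1-t]u≡1 : (1ℚ - t) * u ≡ 1ℚ
        [1-t]u≡1 = ℚₚ.*-inverseʳ (1ℚ - t)
        0≤u : 0ℚ ≤ u
        0≤u = ℚₚ.<⇒≤ (ℚₚ.positive⁻¹ u {{ℚₚ.1/pos⇒pos (1ℚ - t) {{ℚ.positive (0<1-t t<1)}}}})
        unitRow restRow : Fin (suc K) → ℚ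
        unitRow a′ = δ a′ a
        restRow a′ = (d i a′ - δ a′ a * t) * u
        p q : Matrix
        p = Vector.updateAt d i (λ _ → unitRow)
        q = Vector.updateAt d i (λ _ → restRow)
        row-i : ∀ {f} → Vector.updateAt d i f i ≡ f (d i)
        row-i = Vectorₚ.updateAt-updates i d
        row-other : ∀ {f} i′ → i′ ≢ i → Vector.updateAt d i f i′ ≡ d i′
        row-other i′ i′≢i = Vectorₚ.updateAt-minimal i′ i d i′≢i
        unitRow-distribution : IsDistribution unitRow
        unitRow-distribution = distribution (λ a′ → 0≤𝟙 (a′ Finₚ.≟ a)) (trans (sum-cong-≗ (λ a′ → sym (ℚₚ.*-identityʳ (δ a′ a)))) (∑-δ (λ _ → 1ℚ) a))
        restRow-distribution : IsDistribution restRow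
        restRow-distribution = distribution restRow-nonneg sums-to-1
          where
            restRow-nonneg : ∀ a′ → 0ℚ ≤ restRow a′
            restRow-nonneg a′ with a′ Finₚ.≟ a
            ... | yes refl = ℚₚ.≤-reflexive (sym (trans (cong (_* u) (trans (cong (_-_ t) (ℚₚ.*-identityˡ t)) (ℚₚ.+-inverseʳ t)))
                                                        (ℚₚ.*-zeroˡ u)))
            ... | no a′≢a = 0≤x*y (ℚₚ.≤-trans (nonneg (d-stoch i) a′) (ℚₚ.≤-reflexive (sym (trans (cong (_-_ (d i a′)) (ℚₚ.*-zeroˡ t))
                                                                                                    (ℚₚ.+-identityʳ (d i a′))))))
                                  0≤u
            sums-to-1 : sum restRow ≡ 1ℚ
            sums-to-1 =
              begin
                ∑[ a′ < suc K ] ((d i a′ - δ a′ a * t) * u)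
              ≡⟨ sym (*-distribʳ-sum u (λ a′ → d i a′ - δ a′ a * t)) ⟩
                (∑[ a′ < suc K ] (d i a′ - δ a′ a * t)) * u
              ≡⟨ cong (_* u) (trans (∑-distrib-- (d i) (λ a′ → δ a′ a * t)) (cong₂ _-_ (sum≡1 (d-stoch i)) (∑-δ (λ _ → t) a))) ⟩
                (1ℚ - t) * u
              ≡⟨ [1-t]u≡1 ⟩
                1ℚ
              ∎
              where open ≡-Reasoning
        p-stoch : IsStochastic p
        p-stoch i′ with i′ Finₚ.≟ i
        ... | yes refl = subst IsDistribution (sym row-i) unitRow-distribution
        ... | no i′≢i = subst IsDistribution (sym (row-other i′ i′≢i)) (d-stoch i′)
        q-stoch : IsStochastic q
        q-stoch i′ with i′ Finₚ.≟ i
        ... | yes refl = subst IsDistribution (sym row-i) restRow-distribution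
        ... | no i′≢i = subst IsDistribution (sym (row-other i′ i′≢i)) (d-stoch i′)
        d≡mix : ∀ i′ a′ → d i′ a′ ≡ t * p i′ a′ + (1ℚ - t) * q i′ a′
        d≡mix i′ a′ with i′ Finₚ.≟ i
        ... | yes refl rewrite row-i {λ _ → unitRow} | row-i {λ _ → restRow} =
          begin
            d i a′
          ≡⟨ solve 3 (λ x δ t → x := t :* δ :+ (x :- δ :* t)) refl (d i a′) (δ a′ a) t ⟩
            t * δ a′ a + (d i a′ - δ a′ a * t)
          ≡⟨ cong (t * δ a′ a +_) (sym (trans (cong ((d i a′ - δ a′ a * t) *_) [1-t]u≡1) (ℚₚ.*-identityʳ _))) ⟩
            t * δ a′ a + (d i a′ - δ a′ a * t) * ((1ℚ - t) * u)
          ≡⟨ cong (t * δ a′ a +_) (solve 3 (λ x s u → x :* (s :* u) := s :* (x :* u)) refl (d i a′ - δ a′ a * t) (1ℚ - t) u) ⟩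
            t * δ a′ a + (1ℚ - t) * ((d i a′ - δ a′ a * t) * u)
          ∎
          where open ≡-Reasoning
        ... | no i′≢i rewrite row-other {λ _ → unitRow} i′ i′≢i | row-other {λ _ → restRow} i′ i′≢i =
          solve 2 (λ x t → x := t :* x :+ (con 1ℚ :- t) :* x) refl (d i′ a′) t
        p≢q : p i a ≢ q i a
        p≢q pᵢₐ≡qᵢₐ with trans (sym (cong (λ r → r a) row-i)) (trans pᵢₐ≡qᵢₐ (cong (λ r → r a) row-i))
        ... | 1≡rest = contradiction (trans (sym (𝟙-yes (a Finₚ.≟ a) refl)) (trans 1≡rest rest≡0)) λ ()
          where
            rest≡0 : restRow a ≡ 0ℚ
            rest≡0 = trans (cong (λ x → (t - x * t) * u) (𝟙-yes (a Finₚ.≟ a) refl))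
                           (trans (cong (_* u) (trans (cong (_-_ t) (ℚₚ.*-identityˡ t)) (ℚₚ.+-inverseʳ t))) (ℚₚ.*-zeroˡ u))

module NetworkFlows where

  open import Defs
  open import Algebra.Bundles using (CommutativeRing)
  import Algebra.Properties.Semiring.Sum as SemiringSum
  open import Data.Fin as Fin using (Fin; inject₁; fromℕ; toℕ)
  import Data.Fin.Properties as Finₚ
  open import Data.List as List using (List; []; _∷_; _++_; allFin; concatMap; cartesianProductWith; lookup)
  open import Data.List.Membership.Propositional using (_∈_)
  open import Data.List.Membership.Propositional.Properties using (∈-lookup; ∈-allFin; ∈-map⁺; ∈-map⁻; ∈-++⁺ˡ; ∈-++⁺ʳ; ∈-++⁻; ∈-cartesianProductWith⁺; ∈-cartesianProductWith⁻)
  import Data.List.Properties as Listₚ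
  open import Data.List.Relation.Unary.All as All using ([]; _∷_)
  open import Data.List.Relation.Unary.AllPairs using (_∷_)
  open import Data.List.Relation.Unary.Any using (index)
  open import Data.List.Relation.Unary.Any.Properties using (lookup-index)
  open import Data.List.Relation.Unary.Unique.Propositional using (Unique)
  import Data.List.Relation.Unary.Unique.Propositional.Properties as Uniqueₚ
  open import Data.Nat as ℕ using (ℕ; zero; suc)
  import Data.Nat.Properties as ℕₚ
  open import Data.Product using (_×_; _,_; proj₁; proj₂; ∃₂)
  import Data.Product.Properties as Productₚ
  open import Data.Rational as ℚ using (ℚ; 0ℚ; 1ℚ; _+_; _*_; _-_; -_)
  import Data.Rational.Properties as ℚₚ
  open import Data.Rational.Solver using (module +-*-Solver)
  open import Data.Sum using (inj₁; inj₂)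
  open import Data.Vec as Vec using (Vec)
  import Data.Vec.Functional as Vector
  import Data.Vec.Properties as Vecₚ
  open import Function using (_∘_)
  open import Relation.Binary.PropositionalEquality
  open import Relation.Nullary
  open Iverson 0ℚ 1ℚ
  open RationalVectors
  open SemiringSum (CommutativeRing.semiring ℚₚ.+-*-commutativeRing)
  open +-*-Solver

  rightEdge : ∀ {n M} → Fin n → Fin M → Edge n M
  rightEdge i j = node i (inject₁ j) , node i (Fin.suc j)

  downEdge : ∀ {n′ M} → Fin n′ → Fin (suc M) → Edge (suc n′) M
  downEdge i a = node (inject₁ i) a , node (Fin.suc i) a

  sinkEdge : ∀ {n′ M} → Fin (suc M) → Edge (suc n′) M
  sinkEdge {n′} a = node (fromℕ n′) a , sink

  concatMap-map : ∀ {A B C : Set} (f : A → B → C) xs ys →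
    concatMap (λ x → List.map (f x) ys) xs ≡ cartesianProductWith f xs ys
  concatMap-map f [] ys = refl
  concatMap-map f (x ∷ xs) ys = cong (List.map (f x) ys ++_) (concatMap-map f xs ys)

  edges-blocks : ∀ n′ M → edges n′ M ≡ cartesianProductWith rightEdge (allFin (suc n′)) (allFin M)
                                        ++ cartesianProductWith downEdge (allFin n′) (allFin (suc M))
                                        ++ List.map sinkEdge (allFin (suc M))
  edges-blocks n′ M = cong₂ _++_ (concatMap-map rightEdge (allFin (suc n′)) (allFin M))
                                 (cong (_++ List.map sinkEdge (allFin (suc M))) (concatMap-map downEdge (allFin n′) (allFin (suc M))))

  inject₁≢suc : ∀ {K} (i : Fin K) → inject₁ i ≢ Fin.suc i
  inject₁≢suc i e = ℕₚ.1+n≢n (sym (trans (sym (Finₚ.toℕ-inject₁ i)) (cong toℕ e)))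

  rightEdge≢downEdge : ∀ {n′ M} (i : Fin (suc n′)) (j : Fin M) i′ a → rightEdge i j ≢ downEdge i′ a
  rightEdge≢downEdge i j i′ a e = inject₁≢suc i′ (trans (sym (row-injective (cong proj₁ e))) (row-injective (cong proj₂ e)))
    where
      row-injective : ∀ {n m} {i i′ : Fin n} {a a′ : Fin (suc m)} → node i a ≡ node i′ a′ → i ≡ i′
      row-injective refl = refl

  module _ (n′ M : ℕ) where

    unique-edges : Unique (edges n′ M)
    unique-edges = subst Unique (sym (edges-blocks n′ M))
      (Uniqueₚ.++⁺ (Uniqueₚ.cartesianProductWith⁺ rightEdge (λ { refl → refl , refl }) (Uniqueₚ.allFin⁺ (suc n′)) (Uniqueₚ.allFin⁺ M))
         (Uniqueₚ.++⁺ (Uniqueₚ.cartesianProductWith⁺ downEdge down-injective (Uniqueₚ.allFin⁺ n′) (Uniqueₚ.allFin⁺ (suc M)))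
                      (Uniqueₚ.map⁺ (λ { refl → refl }) (Uniqueₚ.allFin⁺ (suc M)))
                      disjoint-DS)
         disjoint-R-DS)
      where
        down-injective : ∀ {i i′ a a′} → downEdge {n′} {M} i a ≡ downEdge i′ a′ → i ≡ i′ × a ≡ a′
        down-injective {i} {i′} e with cong proj₂ e
        ... | refl = Finₚ.suc-injective refl , refl
        disjoint-DS : ∀ {e} → ¬ (e ∈ cartesianProductWith downEdge (allFin n′) (allFin (suc M)) × e ∈ List.map sinkEdge (allFin (suc M)))
        disjoint-DS (e∈D , e∈S) with ∈-cartesianProductWith⁻ downEdge (allFin n′) (allFin (suc M)) e∈D | ∈-map⁻ sinkEdge e∈S
        ... | _ , _ , _ , _ , refl | _ , _ , ()
        disjoint-R-DS : ∀ {e} → ¬ (e ∈ cartesianProductWith rightEdge (allFin (suc n′)) (allFin M) × e ∈ _)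
        disjoint-R-DS (e∈R , e∈DS) with ∈-cartesianProductWith⁻ rightEdge (allFin (suc n′)) (allFin M) e∈R
        ... | i , j , _ , _ , refl with ∈-++⁻ (cartesianProductWith downEdge (allFin n′) (allFin (suc M))) e∈DS
        ...   | inj₁ e∈D with ∈-cartesianProductWith⁻ downEdge (allFin n′) (allFin (suc M)) e∈D
        ...     | i′ , a , _ , _ , e = rightEdge≢downEdge i j i′ a e
        disjoint-R-DS (e∈R , e∈DS) | i , j , _ , _ , refl | inj₂ e∈S with ∈-map⁻ sinkEdge e∈S
        ...     | _ , _ , ()

  lookup-injective : ∀ {A : Set} {xs : List A} → Unique xs → ∀ i j → lookup xs i ≡ lookup xs j → i ≡ j
  lookup-injective {xs = x ∷ xs} _ Fin.zero Fin.zero _ = refl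
  lookup-injective {xs = x ∷ xs} (x∉ ∷ _) Fin.zero (Fin.suc j) x≡ = contradiction x≡ (All.lookup x∉ (∈-lookup j))
  lookup-injective {xs = x ∷ xs} (x∉ ∷ _) (Fin.suc i) Fin.zero ≡x = contradiction (sym ≡x) (All.lookup x∉ (∈-lookup i))
  lookup-injective {xs = x ∷ xs} (_ ∷ xs!) (Fin.suc i) (Fin.suc j) e = cong Fin.suc (lookup-injective xs! i j e)

  foldr-++ : ∀ {A : Set} (G : A → ℚ) xs ys →
    List.foldr _+_ 0ℚ (List.map G (xs ++ ys)) ≡ List.foldr _+_ 0ℚ (List.map G xs) + List.foldr _+_ 0ℚ (List.map G ys)
  foldr-++ G [] ys = sym (ℚₚ.+-identityˡ _)
  foldr-++ G (x ∷ xs) ys = trans (cong (G x +_) (foldr-++ G xs ys)) (sym (ℚₚ.+-assoc (G x) _ _))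

  foldr-tabulate : ∀ {A : Set} K (G : A → ℚ) (g : Fin K → A) →
    List.foldr _+_ 0ℚ (List.map G (List.tabulate g)) ≡ ∑[ k < K ] G (g k)
  foldr-tabulate zero G g = refl
  foldr-tabulate (suc K) G g = cong (G (g Fin.zero) +_) (foldr-tabulate K G (g ∘ Fin.suc))

  foldr-cartesianProductWith : ∀ {A : Set} K L (G : A → ℚ) (f : Fin K → Fin L → A) →
    List.foldr _+_ 0ℚ (List.map G (cartesianProductWith f (allFin K) (allFin L))) ≡ ∑[ k < K ] ∑[ l < L ] G (f k l)
  foldr-cartesianProductWith K L G f =
    trans (go (allFin K)) (trans (foldr-tabulate K _ (λ k → k)) (sum-cong-≗ (λ k → foldr-tabulate L (G ∘ f k) (λ l → l))))
    where
      go : ∀ ks → List.foldr _+_ 0ℚ (List.map G (cartesianProductWith f ks (allFin L)))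
                  ≡ List.foldr _+_ 0ℚ (List.map (λ k → List.foldr _+_ 0ℚ (List.map (G ∘ f k) (allFin L))) ks)
      go [] = refl
      go (k ∷ ks) = trans (foldr-++ G (List.map (f k) (allFin L)) _)
                          (cong₂ _+_ (cong (List.foldr _+_ 0ℚ) (sym (Listₚ.map-∘ (allFin L)))) (go ks))

  foldr-lookup : ∀ {A : Set} (xs : List A) (G : A → ℚ) → ∑[ k < List.length xs ] G (lookup xs k) ≡ List.foldr _+_ 0ℚ (List.map G xs)
  foldr-lookup [] G = refl
  foldr-lookup (x ∷ xs) G = cong (G x +_) (foldr-lookup xs G)

  _≟E_ : ∀ {n m} (e e′ : Edge n m) → Dec (e ≡ e′)
  _≟E_ = Productₚ.≡-dec _≟V_ _≟V_

  module _ (n′ M : ℕ) where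

    data EdgeKind : Edge (suc n′) M → Set where
      right : ∀ i j → EdgeKind (rightEdge i j)
      down : ∀ i a → EdgeKind (downEdge i a)
      toSink : ∀ a → EdgeKind (sinkEdge a)

    edgeKind : ∀ {e} → e ∈ edges n′ M → EdgeKind e
    edgeKind e∈ with ∈-++⁻ (cartesianProductWith rightEdge (allFin (suc n′)) (allFin M)) (subst (_ ∈_) (edges-blocks n′ M) e∈)
    ... | inj₁ e∈R with ∈-cartesianProductWith⁻ rightEdge (allFin (suc n′)) (allFin M) e∈R
    ...   | i , j , _ , _ , refl = right i j
    edgeKind e∈ | inj₂ e∈DS with ∈-++⁻ (cartesianProductWith downEdge (allFin n′) (allFin (suc M))) e∈DS
    ... | inj₁ e∈D with ∈-cartesianProductWith⁻ downEdge (allFin n′) (allFin (suc M)) e∈D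
    ...   | i , a , _ , _ , refl = down i a
    edgeKind e∈ | inj₂ e∈DS | inj₂ e∈S with ∈-map⁻ sinkEdge e∈S
    ...   | a , _ , refl = toSink a

    downEdge∈ : ∀ i a → downEdge i a ∈ edges n′ M
    downEdge∈ i a = subst (_ ∈_) (sym (edges-blocks n′ M))
      (∈-++⁺ʳ (cartesianProductWith rightEdge (allFin (suc n′)) (allFin M)) (∈-++⁺ˡ (∈-cartesianProductWith⁺ downEdge (∈-allFin i) (∈-allFin a))))

    sinkEdge∈ : ∀ a → sinkEdge a ∈ edges n′ M
    sinkEdge∈ a = subst (_ ∈_) (sym (edges-blocks n′ M))
      (∈-++⁺ʳ (cartesianProductWith rightEdge (allFin (suc n′)) (allFin M))
              (∈-++⁺ʳ (cartesianProductWith downEdge (allFin n′) (allFin (suc M))) (∈-map⁺ sinkEdge (∈-allFin a))))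

    valAt : Flow n′ M → Edge (suc n′) M → ℚ
    valAt f e = ∑[ k < #E n′ M ] (𝟙 (lookup (edges n′ M) k ≟E e) * Vec.lookup f k)

    valAt-lookup : ∀ f k → valAt f (lookup (edges n′ M) k) ≡ Vec.lookup f k
    valAt-lookup f k =
      trans (sum-cong-≗ (λ k′ → cong (_* Vec.lookup f k′)
                                  (𝟙-cong (lookup-injective (unique-edges n′ M) k′ k) (cong (lookup (edges n′ M)))
                                          (lookup (edges n′ M) k′ ≟E lookup (edges n′ M) k) (k′ Finₚ.≟ k))))
            (∑-δ (Vec.lookup f) k)

    toFlow : (Edge (suc n′) M → ℚ) → Flow n′ M
    toFlow φ = Vec.tabulate (φ ∘ lookup (edges n′ M))

    toFlow-valAt : ∀ f → toFlow (valAt f) ≡ f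
    toFlow-valAt f = trans (Vecₚ.tabulate-cong (valAt-lookup f)) (Vecₚ.tabulate∘lookup f)

    valAt-toFlow : ∀ φ {e} → e ∈ edges n′ M → valAt (toFlow φ) e ≡ φ e
    valAt-toFlow φ e∈ = subst (λ e → valAt (toFlow φ) e ≡ φ e) (sym (lookup-index e∈))
      (trans (valAt-lookup (toFlow φ) (index e∈)) (Vecₚ.lookup∘tabulate (φ ∘ lookup (edges n′ M)) (index e∈)))

    valAt-∈ : ∀ f {e} (e∈ : e ∈ edges n′ M) → valAt f e ≡ Vec.lookup f (index e∈)
    valAt-∈ f e∈ = subst (λ e → valAt f e ≡ Vec.lookup f (index e∈)) (sym (lookup-index e∈)) (valAt-lookup f (index e∈))

    mix : ℚ → Flow n′ M → Flow n′ M → Flow n′ M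
    mix t g h = Vec.zipWith _+_ (Vec.map (t *_) g) (Vec.map ((1ℚ - t) *_) h)

    lookup-mix : ∀ t g h k → Vec.lookup (mix t g h) k ≡ t * Vec.lookup g k + (1ℚ - t) * Vec.lookup h k
    lookup-mix t g h k = trans (Vecₚ.lookup-zipWith _+_ k (Vec.map (t *_) g) (Vec.map ((1ℚ - t) *_) h))
                               (cong₂ _+_ (Vecₚ.lookup-map k (t *_) g) (Vecₚ.lookup-map k ((1ℚ - t) *_) h))

    valAt-mix : ∀ t g h e → valAt (mix t g h) e ≡ t * valAt g e + (1ℚ - t) * valAt h e
    valAt-mix t g h e =
      trans (sum-cong-≗ (λ k → trans (cong (w k *_) (lookup-mix t g h k))
                                 (solve 4 (λ w t x y → w :* (t :* x :+ (con 1ℚ :- t) :* y) := t :* (w :* x) :+ (con 1ℚ :- t) :* (w :* y)) refl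
                                        (w k) t (Vec.lookup g k) (Vec.lookup h k))))
            (trans (∑-distrib-+ (λ k → t * (w k * Vec.lookup g k)) (λ k → (1ℚ - t) * (w k * Vec.lookup h k)))
                   (sym (cong₂ _+_ (*-distribˡ-sum t (λ k → w k * Vec.lookup g k)) (*-distribˡ-sum (1ℚ - t) (λ k → w k * Vec.lookup h k)))))
      where
        w : Fin (#E n′ M) → ℚ
        w k = 𝟙 (lookup (edges n′ M) k ≟E e)

    toFlow-mix : ∀ t φ ψ → mix t (toFlow φ) (toFlow ψ) ≡ toFlow (λ e → t * φ e + (1ℚ - t) * ψ e)
    toFlow-mix t φ ψ =
      trans (sym (Vecₚ.tabulate∘lookup (mix t (toFlow φ) (toFlow ψ))))
            (Vecₚ.tabulate-cong (λ k → trans (lookup-mix t (toFlow φ) (toFlow ψ) k)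
                                             (cong₂ (λ x y → t * x + (1ℚ - t) * y)
                                                    (Vecₚ.lookup∘tabulate (φ ∘ lookup (edges n′ M)) k)
                                                    (Vecₚ.lookup∘tabulate (ψ ∘ lookup (edges n′ M)) k))))

    toFlow-cong : ∀ {φ ψ} → (∀ {e} → EdgeKind e → φ e ≡ ψ e) → toFlow φ ≡ toFlow ψ
    toFlow-cong h = Vecₚ.tabulate-cong (λ k → h (edgeKind (∈-lookup k)))

    indicator-𝟙 : ∀ (u v : Vertex (suc n′) M) q → indicator u v q ≡ 𝟙 (u ≟V v) * q
    indicator-𝟙 u v q with u ≟V v
    ... | yes _ = sym (ℚₚ.*-identityˡ q)
    ... | no _ = sym (ℚₚ.*-zeroˡ q)

    incidence : Vertex (suc n′) M → Edge (suc n′) M → ℚ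
    incidence v e = 𝟙 (proj₁ e ≟V v) - 𝟙 (proj₂ e ≟V v)

    netFlow-toFlow : ∀ φ v → netFlow n′ M (toFlow φ) v
      ≡ ∑[ i < suc n′ ] ∑[ j < M ] (incidence v (rightEdge i j) * φ (rightEdge i j))
        + (∑[ i < n′ ] ∑[ a < suc M ] (incidence v (downEdge i a) * φ (downEdge i a))
           + ∑[ a < suc M ] (incidence v (sinkEdge a) * φ (sinkEdge a)))
    netFlow-toFlow φ v =
      begin
        netFlow n′ M (toFlow φ) v
      ≡⟨ foldr-tabulate (#E n′ M) (λ k → indicator (proj₁ (e k)) v (Vec.lookup (toFlow φ) k) - indicator (proj₂ (e k)) v (Vec.lookup (toFlow φ) k)) (λ k → k) ⟩
        ∑[ k < #E n′ M ] (indicator (proj₁ (e k)) v (Vec.lookup (toFlow φ) k) - indicator (proj₂ (e k)) v (Vec.lookup (toFlow φ) k))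
      ≡⟨ sum-cong-≗ (λ k → trans (cong₂ _-_ (indicator-𝟙 (proj₁ (e k)) v _) (indicator-𝟙 (proj₂ (e k)) v _))
                             (trans (solve 3 (λ a b c → a :* c :- b :* c := (a :- b) :* c) refl (𝟙 (proj₁ (e k) ≟V v)) (𝟙 (proj₂ (e k) ≟V v)) _)
                                    (cong (incidence v (e k) *_) (Vecₚ.lookup∘tabulate (φ ∘ e) k)))) ⟩
        ∑[ k < #E n′ M ] (incidence v (e k) * φ (e k))
      ≡⟨ foldr-lookup (edges n′ M) (λ e → incidence v e * φ e) ⟩
        List.foldr _+_ 0ℚ (List.map G (edges n′ M))
      ≡⟨ cong (List.foldr _+_ 0ℚ ∘ List.map G) (edges-blocks n′ M) ⟩
        List.foldr _+_ 0ℚ (List.map G (cartesianProductWith rightEdge (allFin (suc n′)) (allFin M) ++ D ++ S))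
      ≡⟨ trans (foldr-++ G (cartesianProductWith rightEdge (allFin (suc n′)) (allFin M)) (D ++ S))
               (cong₂ _+_ (foldr-cartesianProductWith (suc n′) M G rightEdge)
                          (trans (foldr-++ G D S) (cong₂ _+_ (foldr-cartesianProductWith n′ (suc M) G downEdge)
                                                             (trans (cong (List.foldr _+_ 0ℚ) (sym (Listₚ.map-∘ {g = G} {f = sinkEdge} (allFin (suc M)))))
                                                                    (foldr-tabulate (suc M) (G ∘ sinkEdge) (λ a → a)))))) ⟩
        ∑[ i < suc n′ ] ∑[ j < M ] G (rightEdge i j) + (∑[ i < n′ ] ∑[ a < suc M ] G (downEdge i a) + ∑[ a < suc M ] G (sinkEdge a))
      ∎
      where
        open ≡-Reasoning
        e : Fin (#E n′ M) → Edge (suc n′) M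
        e = lookup (edges n′ M)
        G : Edge (suc n′) M → ℚ
        G e = incidence v e * φ e
        D = cartesianProductWith downEdge (allFin n′) (allFin (suc M))
        S = List.map sinkEdge (allFin (suc M))

    incidence-node : ∀ i a i₀ a₀ → 𝟙 (node {suc n′} {M} i a ≟V node i₀ a₀) ≡ δ i i₀ * δ a a₀
    incidence-node i a i₀ a₀ with i Finₚ.≟ i₀ | a Finₚ.≟ a₀
    ... | yes refl | yes refl = refl
    ... | yes refl | no _ = refl
    ... | no _ | yes _ = refl
    ... | no _ | no _ = refl

    -- The edge leaving (i,a) downwards: to (i+1,a), or to the sink from the last row.
    verticalEdge : Fin (suc n′) → Fin (suc M) → Edge (suc n′) M
    verticalEdge i a = ((λ i′ → downEdge i′ a) ∷ʳ sinkEdge a) i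

    module _ (φ : Edge (suc n′) M → ℚ) (i₀ : Fin (suc n′)) (a₀ : Fin (suc M)) where

      private
        v = node i₀ a₀
        r : Fin M → ℚ
        r j = φ (rightEdge i₀ j)
        column : Fin n′ → ℚ
        column i = φ (downEdge i a₀)

      rightBlock-node : ∑[ i < suc n′ ] ∑[ j < M ] (incidence v (rightEdge i j) * φ (rightEdge i j))
                          ≡ (r ∷ʳ 0ℚ) a₀ - (0ℚ Vector.∷ r) a₀
      rightBlock-node =
        trans (sum-cong-≗ (λ i → trans (sum-cong-≗ (λ j → trans (cong (_* φ (rightEdge i j))
                                                                (cong₂ _-_ (incidence-node i (inject₁ j) i₀ a₀) (incidence-node i (Fin.suc j) i₀ a₀)))
                                                          (solve 4 (λ c x y z → (c :* x :- c :* y) :* z := c :* (x :* z :- y :* z)) refl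
                                                                 (δ i i₀) (δ (inject₁ j) a₀) (δ (Fin.suc j) a₀) (φ (rightEdge i j)))))
                                   (sym (*-distribˡ-sum (δ i i₀) (λ j → δ (inject₁ j) a₀ * φ (rightEdge i j) - δ (Fin.suc j) a₀ * φ (rightEdge i j))))))
              (trans (∑-δ (λ i → ∑[ j < M ] (δ (inject₁ j) a₀ * φ (rightEdge i j) - δ (Fin.suc j) a₀ * φ (rightEdge i j))) i₀)
                     (trans (∑-distrib-- (λ j → δ (inject₁ j) a₀ * r j) (λ j → δ (Fin.suc j) a₀ * r j))
                            (cong₂ _-_ (∑-δ-inject₁ r a₀) (∑-δ-suc r a₀))))

      downBlock-node : ∑[ i < n′ ] ∑[ a < suc M ] (incidence v (downEdge i a) * φ (downEdge i a))
                         ≡ (∑[ i < n′ ] (δ (inject₁ i) i₀ * column i)) - (0ℚ Vector.∷ column) i₀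
      downBlock-node =
        trans (sum-cong-≗ (λ i → trans (sum-cong-≗ (λ a → trans (cong (_* φ (downEdge i a))
                                                                (cong₂ _-_ (incidence-node (inject₁ i) a i₀ a₀) (incidence-node (Fin.suc i) a i₀ a₀)))
                                                          (solve 4 (λ c x y z → (x :* c :- y :* c) :* z := c :* (x :* z :- y :* z)) refl
                                                                 (δ a a₀) (δ (inject₁ i) i₀) (δ (Fin.suc i) i₀) (φ (downEdge i a)))))
                                   (∑-δ (λ a → δ (inject₁ i) i₀ * φ (downEdge i a) - δ (Fin.suc i) i₀ * φ (downEdge i a)) a₀)))
              (trans (∑-distrib-- (λ i → δ (inject₁ i) i₀ * column i) (λ i → δ (Fin.suc i) i₀ * column i))
                     (cong (_-_ (∑[ i < n′ ] (δ (inject₁ i) i₀ * column i))) (∑-δ-suc column i₀)))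

      sinkBlock-node : ∑[ a < suc M ] (incidence v (sinkEdge a) * φ (sinkEdge a)) ≡ δ (fromℕ n′) i₀ * φ (sinkEdge a₀)
      sinkBlock-node =
        trans (sum-cong-≗ (λ a → trans (cong (λ x → (x - 0ℚ) * φ (sinkEdge a)) (incidence-node (fromℕ n′) a i₀ a₀))
                                   (solve 3 (λ c x z → (x :* c :- con 0ℚ) :* z := c :* (x :* z)) refl (δ a a₀) (δ (fromℕ n′) i₀) (φ (sinkEdge a)))))
              (∑-δ (λ a → δ (fromℕ n′) i₀ * φ (sinkEdge a)) a₀)

      netFlow-node : netFlow n′ M (toFlow φ) (node i₀ a₀)
                       ≡ ((r ∷ʳ 0ℚ) a₀ - (0ℚ Vector.∷ r) a₀) + (φ (verticalEdge i₀ a₀) - (0ℚ Vector.∷ column) i₀)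
      netFlow-node =
        begin
          netFlow n′ M (toFlow φ) v
        ≡⟨ netFlow-toFlow φ v ⟩
          _
        ≡⟨ cong₂ _+_ rightBlock-node (cong₂ _+_ downBlock-node sinkBlock-node) ⟩
          ((r ∷ʳ 0ℚ) a₀ - (0ℚ Vector.∷ r) a₀) + ((X - Y) + Z)
        ≡⟨ cong (((r ∷ʳ 0ℚ) a₀ - (0ℚ Vector.∷ r) a₀) +_) (solve 3 (λ x y z → (x :- y) :+ z := (x :+ z) :- y) refl X Y Z) ⟩
          ((r ∷ʳ 0ℚ) a₀ - (0ℚ Vector.∷ r) a₀) + ((X + Z) - Y)
        ≡⟨ cong (λ t → ((r ∷ʳ 0ℚ) a₀ - (0ℚ Vector.∷ r) a₀) + (t - Y))
                (trans (∑-δ-∷ʳ column (φ (sinkEdge a₀)) i₀) (sym (map-∷ʳ φ (λ i → downEdge i a₀) (sinkEdge a₀) i₀))) ⟩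
          ((r ∷ʳ 0ℚ) a₀ - (0ℚ Vector.∷ r) a₀) + (φ (verticalEdge i₀ a₀) - Y)
        ∎
        where
          open ≡-Reasoning
          X = ∑[ i < n′ ] (δ (inject₁ i) i₀ * column i)
          Y = (0ℚ Vector.∷ column) i₀
          Z = δ (fromℕ n′) i₀ * φ (sinkEdge a₀)

    netFlow-sink : ∀ φ → netFlow n′ M (toFlow φ) sink ≡ - 1ℚ * ∑[ a < suc M ] φ (sinkEdge a)
    netFlow-sink φ =
      trans (netFlow-toFlow φ sink)
            (trans (cong₂ _+_ (sum-zero (suc n′) _ (λ i → sum-zero M _ (λ j → ℚₚ.*-zeroˡ (φ (rightEdge i j)))))
                              (cong₂ _+_ (sum-zero n′ _ (λ i → sum-zero (suc M) _ (λ a → ℚₚ.*-zeroˡ (φ (downEdge i a)))))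
                                         (sum-cong-≗ (λ a → solve 1 (λ x → (con 0ℚ :- con 1ℚ) :* x := con (- 1ℚ) :* x) refl (φ (sinkEdge a))))))
                   (trans (solve 1 (λ s → con 0ℚ :+ (con 0ℚ :+ s) := s) refl (∑[ a < suc M ] (- 1ℚ * φ (sinkEdge a))))
                          (sym (*-distribˡ-sum (- 1ℚ) (λ a → φ (sinkEdge a))))))

module FlowPolytopeVertices where

  open import Defs
  open import Algebra.Bundles using (CommutativeRing)
  import Algebra.Properties.Semiring.Sum as SemiringSum
  open import Data.Bool using (if_then_else_)
  open import Data.Empty using (⊥; ⊥-elim)
  open import Data.Fin as Fin using (Fin; inject₁; fromℕ; toℕ)
  import Data.Fin.Properties as Finₚ
  open import Data.Fin.Relation.Unary.Top using (view; ‵fromℕ; ‵inject₁)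
  import Data.Integer as ℤ
  import Data.Integer.Properties as ℤₚ
  open import Data.List as List using ([]; _∷_; allFin; cartesianProductWith)
  open import Data.List.Membership.Propositional using (_∈_)
  open import Data.List.Membership.Propositional.Properties using (∈-lookup; ∈-allFin; ∈-cartesianProductWith⁺; ∈-map⁺; ∈-map⁻)
  import Data.List.Properties as Listₚ
  open import Data.List.Relation.Unary.All using ([])
  open import Data.List.Relation.Unary.AllPairs using ([]; _∷_)
  open import Data.List.Relation.Unary.Any using (here)
  open import Data.List.Relation.Unary.Unique.Propositional using (Unique)
  import Data.List.Relation.Unary.Unique.Propositional.Properties as Uniqueₚ
  open import Data.Nat as ℕ using (ℕ; zero; suc; _^_)
  import Data.Nat.Coprimality as Coprimality
  import Data.Nat.Properties as ℕₚ
  open import Data.Product using (_,_; proj₁; proj₂; ∃; ∃₂)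
  open import Data.Rational as ℚ using (ℚ; 0ℚ; 1ℚ; _+_; _*_; _-_; -_; _≤_; _<_)
  import Data.Rational.Properties as ℚₚ
  open import Data.Rational.Solver using (module +-*-Solver)
  open import Data.Sum using (inj₁; inj₂; [_,_]′)
  open import Data.Vec as Vec using (Vec)
  import Data.Vec.Functional as Vector
  import Data.Vec.Properties as Vecₚ
  open import Function using (_∘_)
  open import Relation.Binary.PropositionalEquality
  open import Relation.Nullary
  open RationalVectors
  open NetworkFlows
  open ProductOfSimplices
  open Iverson 0ℚ 1ℚ using (𝟙-yes; 𝟙-no)
  open SemiringSum (CommutativeRing.semiring ℚₚ.+-*-commutativeRing)
  open +-*-Solver

  toℚ-suc : ∀ k → toℚ (suc k) ≡ 1ℚ + toℚ k
  toℚ-suc k =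
    sym (trans (cong (1ℚ +_) (ℚₚ.normalize-coprime (Coprimality.sym (Coprimality.1-coprimeTo k))))
                 (cong (ℚ._/ 1) (trans (cong (ℤ._+_ (ℤ.+ 1)) (ℤₚ.*-identityʳ (ℤ.+ k))) (sym (ℤₚ.pos-+ 1 k)))))

  allVecs-as-product : ∀ K N → allVecs K (suc N) ≡ cartesianProductWith Vec._∷_ (allFin K) (allVecs K N)
  allVecs-as-product K N = concatMap-map Vec._∷_ (allFin K) (allVecs K N)

  allVecs-complete : ∀ K N (v : Vec (Fin K) N) → v ∈ allVecs K N
  allVecs-complete K zero Vec.[] = here refl
  allVecs-complete K (suc N) (x Vec.∷ v) =
    subst (_ ∈_) (sym (allVecs-as-product K N)) (∈-cartesianProductWith⁺ Vec._∷_ (∈-allFin x) (allVecs-complete K N v))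

  allVecs-unique : ∀ K N → Unique (allVecs K N)
  allVecs-unique K zero = [] ∷ []
  allVecs-unique K (suc N) =
    subst Unique (sym (allVecs-as-product K N))
          (Uniqueₚ.cartesianProductWith⁺ Vec._∷_ (λ { refl → refl , refl }) (Uniqueₚ.allFin⁺ K) (allVecs-unique K N))

  length-cartesianProductWith : ∀ {A B C : Set} (f : A → B → C) xs ys →
    List.length (cartesianProductWith f xs ys) ≡ List.length xs ℕ.* List.length ys
  length-cartesianProductWith f [] ys = refl
  length-cartesianProductWith f (x ∷ xs) ys =
    trans (Listₚ.length-++ (List.map (f x) ys)) (cong₂ ℕ._+_ (Listₚ.length-map (f x) ys) (length-cartesianProductWith f xs ys))

  length-allVecs : ∀ K N → List.length (allVecs K N) ≡ K ^ N
  length-allVecs K zero = refl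
  length-allVecs K (suc N) =
    trans (cong List.length (allVecs-as-product K N))
          (trans (length-cartesianProductWith Vec._∷_ (allFin K) (allVecs K N))
                 (cong₂ ℕ._*_ (Listₚ.length-tabulate {n = K} (λ x → x)) (length-allVecs K N)))

  module _ (n′ m₀ : ℕ) where

    M : ℕ
    M = suc m₀

    data ColumnView : Fin (suc M) → Set where
      first : ColumnView Fin.zero
      middle : ∀ j → ColumnView (Fin.suc (inject₁ j))
      last : ColumnView (fromℕ M)

    columnView : ∀ a → ColumnView a
    columnView Fin.zero = first
    columnView (Fin.suc a) with view a
    ... | ‵fromℕ = last
    ... | ‵inject₁ j = middle j

    demand′ : Vertex (suc n′) M → ℚ
    demand′ = demand n′ M aVec bVec

    demand-middle : ∀ i j → demand′ (node i (Fin.suc (inject₁ j))) ≡ 0ℚ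
    demand-middle i j with toℕ (Fin.suc (inject₁ j)) ℕ.≟ M
    ... | yes e = contradiction (trans (sym (Finₚ.toℕ-inject₁ j)) (ℕₚ.suc-injective e)) (ℕₚ.<⇒≢ (Finₚ.toℕ<n j))
    ... | no _ = refl

    demand-last : ∀ i → demand′ (node i (fromℕ M)) ≡ 0ℚ - toℚ (bVec i)
    demand-last i with toℕ (fromℕ M) ℕ.≟ M
    ... | yes _ = refl
    ... | no ≢M = contradiction (Finₚ.toℕ-fromℕ M) ≢M

    demand-sink : demand′ sink ≡ - 1ℚ
    demand-sink =
      trans (cong₂ (λ x y → toℚ x - toℚ y) (ones n′ (Fin.suc) bVec (λ _ → refl)) (ones (suc n′) (λ i → i) aVec (λ _ → refl)))
            (trans (cong (_-_ (toℚ n′)) (toℚ-suc n′)) (solve 1 (λ x → x :- (con 1ℚ :+ x) := :- con 1ℚ) refl (toℚ n′)))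
      where
        ones : ∀ {A : Set} K (g : Fin K → A) (h : A → ℕ) → (∀ x → h (g x) ≡ 1) → List.foldr ℕ._+_ 0 (List.map h (List.tabulate g)) ≡ K
        ones zero g h e = refl
        ones (suc K) g h e = cong₂ ℕ._+_ (e Fin.zero) (ones K (g ∘ Fin.suc) h (e ∘ Fin.suc))

    Mat : Set
    Mat = Matrix {suc n′} {M}

    above : Mat → Mat
    above d Fin.zero a = 0ℚ
    above d (Fin.suc i) a = d (inject₁ i) a

    -- Conservation at the nodes (i,0), …, (i,j) forces this flow on the edge (i,j) → (i,j+1).
    rowFlow : Mat → Fin (suc n′) → Fin M → ℚ
    rowFlow d i j = 1ℚ + partialSum (above d i) (inject₁ j) - partialSum (d i) (inject₁ j)

    -- Only the values on edges of G(n,m) matter: between two nodes, an edge inside a row is a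
    -- right edge and any other edge is a down edge.
    edgeFlow : Mat → Edge (suc n′) M → ℚ
    edgeFlow d (node i a , sink) = d i a
    edgeFlow d (node i a , node i′ Fin.zero) = d i a
    edgeFlow d (node i a , node i′ (Fin.suc j)) = if does (i Finₚ.≟ i′) then rowFlow d i j else d i a
    edgeFlow d (sink , _) = 0ℚ

    lift : Mat → Flow n′ M
    lift d = toFlow n′ M (edgeFlow d)

    proj : Flow n′ M → Mat
    proj f i a = valAt n′ M f (verticalEdge n′ M i a)

    nodeBalance : (Fin M → ℚ) → Mat → Fin (suc n′) → Fin (suc M) → ℚ
    nodeBalance r d i a = ((r ∷ʳ 0ℚ) a - (0ℚ Vector.∷ r) a) + (d i a - above d i a)

    above-cong : ∀ {d d′} → (∀ i a → d i a ≡ d′ i a) → ∀ i a → above d i a ≡ above d′ i a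
    above-cong d≗d′ Fin.zero a = refl
    above-cong d≗d′ (Fin.suc i) a = d≗d′ (inject₁ i) a

    nodeBalance-cong : ∀ {r r′ d d′} → (∀ j → r j ≡ r′ j) → (∀ i a → d i a ≡ d′ i a) → ∀ i a →
                       nodeBalance r d i a ≡ nodeBalance r′ d′ i a
    nodeBalance-cong {r} {r′} r≗r′ d≗d′ i a =
      cong₂ _+_ (cong₂ _-_ (∷ʳ-cong 0ℚ r≗r′ a) (inflow a))
                (cong₂ _-_ (d≗d′ i a) (above-cong d≗d′ i a))
      where
        inflow : ∀ a → (0ℚ Vector.∷ r) a ≡ (0ℚ Vector.∷ r′) a
        inflow Fin.zero = refl
        inflow (Fin.suc j) = r≗r′ j

    netFlow-balance : ∀ φ i a → netFlow n′ M (toFlow n′ M φ) (node i a)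
                                ≡ nodeBalance (λ j → φ (rightEdge i j)) (λ i a → φ (verticalEdge n′ M i a)) i a
    netFlow-balance φ i a =
      trans (netFlow-node n′ M φ i a)
            (cong (λ t → ((r ∷ʳ 0ℚ) a - (0ℚ Vector.∷ r) a) + (φ (verticalEdge n′ M i a) - t)) (inflow i))
      where
        r : Fin M → ℚ
        r j = φ (rightEdge i j)
        inflow : ∀ i → (0ℚ Vector.∷ (λ i′ → φ (downEdge i′ a))) i ≡ above (λ i a → φ (verticalEdge n′ M i a)) i a
        inflow Fin.zero = refl
        inflow (Fin.suc i′) = cong φ (sym (∷ʳ-inject₁ (λ i′ → downEdge i′ a) (sinkEdge a) i′))

    edgeFlow-right : ∀ d i j → edgeFlow d (rightEdge i j) ≡ rowFlow d i j
    edgeFlow-right d i j with i Finₚ.≟ i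
    ... | yes _ = refl
    ... | no i≢i = contradiction refl i≢i

    edgeFlow-down : ∀ d i a → edgeFlow d (downEdge i a) ≡ d (inject₁ i) a
    edgeFlow-down d i Fin.zero = refl
    edgeFlow-down d i (Fin.suc j) with inject₁ i Finₚ.≟ Fin.suc i
    ... | yes e = contradiction e (inject₁≢suc i)
    ... | no _ = refl

    edgeFlow-vertical : ∀ d i a → edgeFlow d (verticalEdge n′ M i a) ≡ d i a
    edgeFlow-vertical d i a =
      trans (map-∷ʳ (edgeFlow d) (λ i′ → downEdge i′ a) (sinkEdge a) i)
            (trans (∷ʳ-cong (d (fromℕ n′) a) (λ i′ → edgeFlow-down d i′ a) i) (init∷ʳlast (λ i → d i a) i))

    module _ (r : Fin M → ℚ) (d : Mat) (i : Fin (suc n′)) where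

      private
        h : Fin M → ℚ
        h j = r j - rowFlow d i j

      balance-first : nodeBalance r d i Fin.zero ≡ h Fin.zero + 1ℚ
      balance-first = solve 3 (λ x p q → (x :- con 0ℚ) :+ (q :- p) := (x :- (con 1ℚ :+ p :- q)) :+ con 1ℚ) refl
                            (r Fin.zero) (above d i Fin.zero) (d i Fin.zero)

      balance-middle : ∀ j → nodeBalance r d i (Fin.suc (inject₁ j)) ≡ h (Fin.suc j) - h (inject₁ j)
      balance-middle j =
        begin
          ((r ∷ʳ 0ℚ) (Fin.suc (inject₁ j)) - r (inject₁ j)) + (q - p)
        ≡⟨ cong (λ t → (t - r (inject₁ j)) + (q - p)) (∷ʳ-inject₁ (r ∘ Fin.suc) 0ℚ j) ⟩
          (r (Fin.suc j) - r (inject₁ j)) + (q - p)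
        ≡⟨ solve 6 (λ x y P Q p q → (x :- y) :+ (q :- p)
                                     := (x :- (con 1ℚ :+ (P :+ p) :- (Q :+ q))) :- (y :- (con 1ℚ :+ P :- Q))) refl
                 (r (Fin.suc j)) (r (inject₁ j)) (partialSum (above d i) (inject₁ (inject₁ j))) (partialSum (d i) (inject₁ (inject₁ j))) p q ⟩
          (r (Fin.suc j) - (1ℚ + (partialSum (above d i) (inject₁ (inject₁ j)) + p) - (partialSum (d i) (inject₁ (inject₁ j)) + q))) - h (inject₁ j)
        ≡⟨ cong₂ (λ x y → (r (Fin.suc j) - (1ℚ + x - y)) - h (inject₁ j))
                 (sym (partialSum-suc (above d i) (inject₁ j))) (sym (partialSum-suc (d i) (inject₁ j))) ⟩
          h (Fin.suc j) - h (inject₁ j)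
        ∎
        where
          open ≡-Reasoning
          p = above d i (Fin.suc (inject₁ j))
          q = d i (Fin.suc (inject₁ j))

      balance-last : nodeBalance r d i (fromℕ M) ≡ (sum (d i) - sum (above d i) - 1ℚ) - h (fromℕ m₀)
      balance-last =
        begin
          ((r ∷ʳ 0ℚ) (fromℕ M) - r (fromℕ m₀)) + (q - p)
        ≡⟨ cong (λ t → (t - r (fromℕ m₀)) + (q - p)) (∷ʳ-fromℕ M r 0ℚ) ⟩
          (0ℚ - r (fromℕ m₀)) + (q - p)
        ≡⟨ solve 5 (λ x P Q p q → (con 0ℚ :- x) :+ (q :- p) := ((Q :+ q) :- (P :+ p) :- con 1ℚ) :- (x :- (con 1ℚ :+ P :- Q))) refl
                 (r (fromℕ m₀)) (partialSum (above d i) (inject₁ (fromℕ m₀))) (partialSum (d i) (inject₁ (fromℕ m₀))) p q ⟩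
          ((partialSum (d i) (inject₁ (fromℕ m₀)) + q) - (partialSum (above d i) (inject₁ (fromℕ m₀)) + p) - 1ℚ) - h (fromℕ m₀)
        ≡⟨ cong₂ (λ x y → (x - y - 1ℚ) - h (fromℕ m₀)) (sym (total (d i))) (sym (total (above d i))) ⟩
          (sum (d i) - sum (above d i) - 1ℚ) - h (fromℕ m₀)
        ∎
        where
          open ≡-Reasoning
          p = above d i (fromℕ M)
          q = d i (fromℕ M)
          total : ∀ g → sum g ≡ partialSum g (inject₁ (fromℕ m₀)) + g (fromℕ M)
          total g = trans (sym (partialSum-last M g)) (partialSum-suc g (fromℕ m₀))

    sum-above : ∀ {d} → IsStochastic d → ∀ i → sum (above d i) ≡ toℚ (bVec i)
    sum-above d-stoch Fin.zero = sum-zero (suc M) _ (λ _ → refl)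
    sum-above d-stoch (Fin.suc i) = sum≡1 (d-stoch (inject₁ i))

    rowFlow-balance : ∀ {d} → IsStochastic d → ∀ i a → nodeBalance (rowFlow d i) d i a ≡ demand′ (node i a)
    rowFlow-balance {d} d-stoch i a with columnView a
    ... | first = trans (balance-first (rowFlow d i) d i) (cong (_+ 1ℚ) (ℚₚ.+-inverseʳ (rowFlow d i Fin.zero)))
    ... | middle j = trans (balance-middle (rowFlow d i) d i j)
                           (trans (cong₂ _-_ (ℚₚ.+-inverseʳ (rowFlow d i (Fin.suc j))) (ℚₚ.+-inverseʳ (rowFlow d i (inject₁ j))))
                                  (sym (demand-middle i j)))
    ... | last =
      begin
        nodeBalance (rowFlow d i) d i (fromℕ M)
      ≡⟨ balance-last (rowFlow d i) d i ⟩
        (sum (d i) - sum (above d i) - 1ℚ) - (rowFlow d i (fromℕ m₀) - rowFlow d i (fromℕ m₀))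
      ≡⟨ cong₂ (λ x y → (x - y - 1ℚ) - (rowFlow d i (fromℕ m₀) - rowFlow d i (fromℕ m₀))) (sum≡1 (d-stoch i)) (sum-above d-stoch i) ⟩
        (1ℚ - toℚ (bVec i) - 1ℚ) - (rowFlow d i (fromℕ m₀) - rowFlow d i (fromℕ m₀))
      ≡⟨ solve 2 (λ b r → (con 1ℚ :- b :- con 1ℚ) :- (r :- r) := con 0ℚ :- b) refl (toℚ (bVec i)) (rowFlow d i (fromℕ m₀)) ⟩
        0ℚ - toℚ (bVec i)
      ≡⟨ sym (demand-last i) ⟩
        demand′ (node i (fromℕ M))
      ∎
      where open ≡-Reasoning

    above-nonneg : ∀ {d} → IsStochastic d → ∀ i a → 0ℚ ≤ above d i a
    above-nonneg d-stoch Fin.zero a = ℚₚ.≤-refl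
    above-nonneg d-stoch (Fin.suc i) a = nonneg (d-stoch (inject₁ i)) a

    rowFlow-nonneg : ∀ {d} → IsStochastic d → ∀ i j → 0ℚ ≤ rowFlow d i j
    rowFlow-nonneg {d} d-stoch i j =
      ℚₚ.≤-trans (0≤x+y (partialSum-nonneg (above d i) (above-nonneg d-stoch i) (inject₁ j)) 0≤1-Q)
                 (ℚₚ.≤-reflexive (solve 2 (λ P Q → P :+ (con 1ℚ :- Q) := con 1ℚ :+ P :- Q) refl
                                         (partialSum (above d i) (inject₁ j)) (partialSum (d i) (inject₁ j))))
      where
        Q≤1 : partialSum (d i) (inject₁ j) ≤ 1ℚ
        Q≤1 = ℚₚ.≤-trans (partialSum≤sum (d i) (nonneg (d-stoch i)) (inject₁ j)) (ℚₚ.≤-reflexive (sum≡1 (d-stoch i)))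
        0≤1-Q : 0ℚ ≤ 1ℚ - partialSum (d i) (inject₁ j)
        0≤1-Q = ℚₚ.≤-trans (ℚₚ.≤-reflexive (sym (ℚₚ.+-inverseʳ (partialSum (d i) (inject₁ j))))) (ℚₚ.+-monoˡ-≤ _ Q≤1)

    lift-feasible : ∀ d → IsStochastic d → InPolytope n′ M aVec bVec (lift d)
    lift-feasible d d-stoch = flow-nonneg , balanced
      where
        edgeFlow-nonneg : ∀ {e} → EdgeKind n′ M e → 0ℚ ≤ edgeFlow d e
        edgeFlow-nonneg (right i j) = ℚₚ.≤-trans (rowFlow-nonneg d-stoch i j) (ℚₚ.≤-reflexive (sym (edgeFlow-right d i j)))
        edgeFlow-nonneg (down i a) = ℚₚ.≤-trans (nonneg (d-stoch (inject₁ i)) a) (ℚₚ.≤-reflexive (sym (edgeFlow-down d i a)))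
        edgeFlow-nonneg (toSink a) = nonneg (d-stoch (fromℕ n′)) a
        flow-nonneg : ∀ k → 0ℚ ≤ Vec.lookup (lift d) k
        flow-nonneg k = ℚₚ.≤-trans (edgeFlow-nonneg (edgeKind n′ M (∈-lookup k)))
                              (ℚₚ.≤-reflexive (sym (Vecₚ.lookup∘tabulate (edgeFlow d ∘ List.lookup (edges n′ M)) k)))
        balanced : ∀ v → netFlow n′ M (lift d) v ≡ demand′ v
        balanced (node i a) = trans (netFlow-balance (edgeFlow d) i a)
                                    (trans (nodeBalance-cong (edgeFlow-right d i) (edgeFlow-vertical d) i a)
                                           (rowFlow-balance d-stoch i a))
        balanced sink = trans (netFlow-sink n′ M (edgeFlow d))
                              (trans (cong (- 1ℚ *_) (sum≡1 (d-stoch (fromℕ n′)))) (sym demand-sink))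

    verticalEdge∈ : ∀ i a → verticalEdge n′ M i a ∈ edges n′ M
    verticalEdge∈ i a = ∷ʳ-all (_∈ edges n′ M) (λ i′ → downEdge∈ n′ M i′ a) (sinkEdge∈ n′ M a) i

    proj-lift : ∀ d i a → proj (lift d) i a ≡ d i a
    proj-lift d i a = trans (valAt-toFlow n′ M (edgeFlow d) (verticalEdge∈ i a)) (edgeFlow-vertical d i a)

    module _ (f : Flow n′ M) (f-feasible : InPolytope n′ M aVec bVec f) where

      private
        φ : Edge (suc n′) M → ℚ
        φ = valAt n′ M f
        r : Fin (suc n′) → Fin M → ℚ
        r i j = φ (rightEdge i j)

      flow-balance : ∀ i a → nodeBalance (r i) (proj f) i a ≡ demand′ (node i a)
      flow-balance i a = trans (sym (netFlow-balance φ i a))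
                               (trans (cong (λ g → netFlow n′ M g (node i a)) (toFlow-valAt n′ M f)) (proj₂ f-feasible (node i a)))

      rightFlow≡rowFlow : ∀ i j → r i j ≡ rowFlow (proj f) i j
      rightFlow≡rowFlow i j = x-y≡0⇒x≡y (trans (constant-by-steps m₀ h step j) h₀≡0)
        where
          h : Fin M → ℚ
          h j = r i j - rowFlow (proj f) i j
          h₀≡0 : h Fin.zero ≡ 0ℚ
          h₀≡0 = trans (solve 1 (λ x → x := (x :+ con 1ℚ) :- con 1ℚ) refl (h Fin.zero))
                       (trans (cong (_- 1ℚ) (trans (sym (balance-first (r i) (proj f) i)) (flow-balance i Fin.zero)))
                              (ℚₚ.+-inverseʳ 1ℚ))
          step : ∀ j → h (Fin.suc j) ≡ h (inject₁ j)
          step j = x-y≡0⇒x≡y (trans (sym (balance-middle (r i) (proj f) i j))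
                                    (trans (flow-balance i (Fin.suc (inject₁ j))) (demand-middle i j)))

      proj-row-sum : ∀ i → sum (proj f i) - sum (above (proj f) i) - 1ℚ ≡ 0ℚ - toℚ (bVec i)
      proj-row-sum i =
        begin
          X
        ≡⟨ sym (ℚₚ.+-identityʳ X) ⟩
          X - 0ℚ
        ≡⟨ cong (_-_ X) (sym (trans (cong (_- rowFlow (proj f) i (fromℕ m₀)) (rightFlow≡rowFlow i (fromℕ m₀)))
                                      (ℚₚ.+-inverseʳ (rowFlow (proj f) i (fromℕ m₀))))) ⟩
          X - (r i (fromℕ m₀) - rowFlow (proj f) i (fromℕ m₀))
        ≡⟨ sym (balance-last (r i) (proj f) i) ⟩
          nodeBalance (r i) (proj f) i (fromℕ M)
        ≡⟨ trans (flow-balance i (fromℕ M)) (demand-last i) ⟩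
          0ℚ - toℚ (bVec i)
        ∎
        where
          open ≡-Reasoning
          X = sum (proj f i) - sum (above (proj f) i) - 1ℚ

      proj-stochastic : IsStochastic (proj f)
      proj-stochastic i = distribution proj-nonneg (trans (constant-by-steps n′ H step i) H₀≡1)
        where
          proj-nonneg : ∀ a → 0ℚ ≤ proj f i a
          proj-nonneg a = ℚₚ.≤-trans (proj₁ f-feasible _) (ℚₚ.≤-reflexive (sym (valAt-∈ n′ M f (verticalEdge∈ i a))))
          H : Fin (suc n′) → ℚ
          H i = sum (proj f i)
          H₀≡1 : H Fin.zero ≡ 1ℚ
          H₀≡1 = trans (solve 1 (λ x → x := (x :- con 0ℚ :- con 1ℚ) :+ con 1ℚ) refl (H Fin.zero))
                       (trans (cong (λ t → (H Fin.zero - t - 1ℚ) + 1ℚ) (sym (sum-zero (suc M) (above (proj f) Fin.zero) (λ _ → refl))))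
                              (cong (_+ 1ℚ) (proj-row-sum Fin.zero)))
          step : ∀ i → H (Fin.suc i) ≡ H (inject₁ i)
          step i = x-y≡0⇒x≡y (trans (solve 2 (λ x y → x :- y := (x :- y :- con 1ℚ) :+ con 1ℚ) refl (H (Fin.suc i)) (H (inject₁ i)))
                                    (cong (_+ 1ℚ) (proj-row-sum (Fin.suc i))))

      lift-proj : lift (proj f) ≡ f
      lift-proj = trans (toFlow-cong n′ M agree) (toFlow-valAt n′ M f)
        where
          agree : ∀ {e} → EdgeKind n′ M e → edgeFlow (proj f) e ≡ φ e
          agree (right i j) = trans (edgeFlow-right (proj f) i j) (sym (rightFlow≡rowFlow i j))
          agree (down i a) = trans (edgeFlow-down (proj f) i a) (cong φ (∷ʳ-inject₁ (λ i′ → downEdge i′ a) (sinkEdge a) i))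
          agree (toSink a) = cong φ (∷ʳ-fromℕ n′ (λ i′ → downEdge i′ a) (sinkEdge a))

    above-mix : ∀ t {d p q} → (∀ i a → d i a ≡ t * p i a + (1ℚ - t) * q i a) →
                ∀ i a → above d i a ≡ t * above p i a + (1ℚ - t) * above q i a
    above-mix t d≡ Fin.zero a = solve 1 (λ t → con 0ℚ := t :* con 0ℚ :+ (con 1ℚ :- t) :* con 0ℚ) refl t
    above-mix t d≡ (Fin.suc i) a = d≡ (inject₁ i) a

    rowFlow-mix : ∀ t {d p q} → (∀ i a → d i a ≡ t * p i a + (1ℚ - t) * q i a) →
                  ∀ i j → rowFlow d i j ≡ t * rowFlow p i j + (1ℚ - t) * rowFlow q i j
    rowFlow-mix t {d} {p} {q} d≡ i j =
      trans (cong₂ (λ x y → 1ℚ + x - y)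
                   (trans (partialSum-cong (above-mix t d≡ i) (inject₁ j)) (partialSum-linear t (1ℚ - t) (above p i) (above q i) (inject₁ j)))
                   (trans (partialSum-cong (d≡ i) (inject₁ j)) (partialSum-linear t (1ℚ - t) (p i) (q i) (inject₁ j))))
            (solve 5 (λ t a b c e → con 1ℚ :+ (t :* a :+ (con 1ℚ :- t) :* b) :- (t :* c :+ (con 1ℚ :- t) :* e)
                                    := t :* (con 1ℚ :+ a :- c) :+ (con 1ℚ :- t) :* (con 1ℚ :+ b :- e)) refl
                   t (partialSum (above p i) (inject₁ j)) (partialSum (above q i) (inject₁ j))
                     (partialSum (p i) (inject₁ j)) (partialSum (q i) (inject₁ j)))

    lift-mix : ∀ t {d p q} → (∀ i a → d i a ≡ t * p i a + (1ℚ - t) * q i a) → lift d ≡ mix n′ M t (lift p) (lift q)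
    lift-mix t {d} {p} {q} d≡ = trans (toFlow-cong n′ M agree) (sym (toFlow-mix n′ M t (edgeFlow p) (edgeFlow q)))
      where
        agree : ∀ {e} → EdgeKind n′ M e → edgeFlow d e ≡ t * edgeFlow p e + (1ℚ - t) * edgeFlow q e
        agree (right i j) = trans (edgeFlow-right d i j)
                                  (trans (rowFlow-mix t d≡ i j)
                                         (sym (cong₂ (λ x y → t * x + (1ℚ - t) * y) (edgeFlow-right p i j) (edgeFlow-right q i j))))
        agree (down i a) = trans (edgeFlow-down d i a)
                                 (trans (d≡ (inject₁ i) a)
                                        (sym (cong₂ (λ x y → t * x + (1ℚ - t) * y) (edgeFlow-down p i a) (edgeFlow-down q i a))))
        agree (toSink a) = d≡ (fromℕ n′) a

    lift-cong : ∀ {d d′} → (∀ i a → d i a ≡ d′ i a) → lift d ≡ lift d′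
    lift-cong {d} {d′} d≗d′ = toFlow-cong n′ M agree
      where
        agree : ∀ {e} → EdgeKind n′ M e → edgeFlow d e ≡ edgeFlow d′ e
        agree (right i j) = trans (edgeFlow-right d i j)
                                  (trans (cong₂ (λ x y → 1ℚ + x - y) (partialSum-cong (above-cong d≗d′ i) (inject₁ j)) (partialSum-cong (d≗d′ i) (inject₁ j)))
                                         (sym (edgeFlow-right d′ i j)))
        agree (down i a) = trans (edgeFlow-down d i a) (trans (d≗d′ (inject₁ i) a) (sym (edgeFlow-down d′ i a)))
        agree (toSink a) = d≗d′ (fromℕ n′) a

    proj-mix : ∀ t g h i a → proj (mix n′ M t g h) i a ≡ t * proj g i a + (1ℚ - t) * proj h i a
    proj-mix t g h i a = valAt-mix n′ M t g h (verticalEdge n′ M i a)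

    IsVertex′ : Flow n′ M → Set
    IsVertex′ = IsVertex n′ M aVec bVec

    lift-unit-isVertex : ∀ c → IsVertex′ (lift (unitMatrix c))
    lift-unit-isVertex c = lift-feasible (unitMatrix c) (unitMatrix-stochastic c) , extreme
      where
        extreme : ∀ g h t → InPolytope n′ M aVec bVec g → InPolytope n′ M aVec bVec h → 0ℚ < t → t < 1ℚ →
                  lift (unitMatrix c) ≡ mix n′ M t g h → g ≡ h
        extreme g h t g-feasible h-feasible 0<t t<1 unit≡mix =
          begin
            g                 ≡⟨ sym (lift-proj g g-feasible) ⟩
            lift (proj g)     ≡⟨ lift-cong {proj g} {proj h} (unitMatrix-extreme c (proj g) (proj h) (proj-stochastic g g-feasible)
                                                                                 (proj-stochastic h h-feasible) 0<t t<1 unit≡proj-mix) ⟩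
            lift (proj h)     ≡⟨ lift-proj h h-feasible ⟩
            h                 ∎
          where
            open ≡-Reasoning
            unit≡proj-mix : ∀ i a → unitMatrix c i a ≡ t * proj g i a + (1ℚ - t) * proj h i a
            unit≡proj-mix i a = trans (sym (proj-lift (unitMatrix c) i a))
                                      (trans (cong (λ f → proj f i a) unit≡mix) (proj-mix t g h i a))

    fractional-not-vertex : ∀ f → IsVertex′ f → ∀ i a → 0ℚ < proj f i a → proj f i a < 1ℚ → ⊥
    fractional-not-vertex f (f-feasible , f-extreme) i a 0<t t<1 = separated (trans (sym (proj-lift p i a)) (trans (cong (λ g → proj g i a) lift-p≡lift-q) (proj-lift q i a)))
      where
        open Split (split-at-fractional (proj f) (proj-stochastic f f-feasible) i a 0<t t<1)
        lift-p≡lift-q : lift p ≡ lift q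
        lift-p≡lift-q = f-extreme (lift p) (lift q) (proj f i a) (lift-feasible p p-stochastic) (lift-feasible q q-stochastic) 0<t t<1
                                  (trans (sym (lift-proj f f-feasible)) (lift-mix (proj f i a) {proj f} {p} {q} decomposition))

    vertex⇒lift-unit : ∀ f → IsVertex′ f → ∃ λ c → f ≡ lift (unitMatrix c)
    vertex⇒lift-unit f f-vertex@(f-feasible , _) =
      [ (λ { (c , f≗unit) → c , trans (sym (lift-proj f f-feasible)) (lift-cong {proj f} {unitMatrix c} f≗unit) })
      , (λ { (i , a , 0<t , t<1) → ⊥-elim (fractional-not-vertex f f-vertex i a 0<t t<1) }) ]′
        (stochastic-unit-or-fractional (proj f) (proj-stochastic f f-feasible))

    lift-unit-injective : ∀ {c c′} → lift (unitMatrix c) ≡ lift (unitMatrix c′) → c ≡ c′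
    lift-unit-injective {c} {c′} e =
      trans (sym (Vecₚ.tabulate∘lookup c)) (trans (Vecₚ.tabulate-cong same) (Vecₚ.tabulate∘lookup c′))
      where
        same : ∀ i → Vec.lookup c i ≡ Vec.lookup c′ i
        same i with Vec.lookup c i Finₚ.≟ Vec.lookup c′ i
        ... | yes cᵢ≡c′ᵢ = cᵢ≡c′ᵢ
        ... | no cᵢ≢c′ᵢ = contradiction
          (trans (sym (𝟙-yes (Vec.lookup c i Finₚ.≟ Vec.lookup c i) refl))
                 (trans (sym (proj-lift (unitMatrix c) i (Vec.lookup c i)))
                        (trans (cong (λ f → proj f i (Vec.lookup c i)) e)
                               (trans (proj-lift (unitMatrix c′) i (Vec.lookup c i)) (𝟙-no (Vec.lookup c i Finₚ.≟ Vec.lookup c′ i) cᵢ≢c′ᵢ)))))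
          λ ()

    vertex-count : HasVertexCount n′ M aVec bVec (suc M ^ suc n′)
    vertex-count =
      List.map (lift ∘ unitMatrix) (allVecs (suc M) (suc n′)) ,
      Uniqueₚ.map⁺ lift-unit-injective (allVecs-unique (suc M) (suc n′)) ,
      (λ f f∈ → let c , _ , f≡ = ∈-map⁻ (lift ∘ unitMatrix) f∈ in subst IsVertex′ (sym f≡) (lift-unit-isVertex c)) ,
      (λ f f-vertex → let c , f≡ = vertex⇒lift-unit f f-vertex in
                      subst (_∈ _) (sym f≡) (∈-map⁺ (lift ∘ unitMatrix) (allVecs-complete (suc M) (suc n′) c))) ,
      trans (Listₚ.length-map (lift ∘ unitMatrix) (allVecs (suc M) (suc n′))) (length-allVecs (suc M) (suc n′))

open import Defs using (HasVertexCount; aVec; bVec; oneMinusX; _^ˢ_; _·_; eulerNumerator)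
open import Data.Nat using (ℕ; zero; suc; _^_)
open import Data.Nat.Properties using (^-zeroˡ)
open import Data.Integer using (+_)
open import Data.Product using (Σ; _×_; _,_)
open import Relation.Binary.PropositionalEquality using (_≡_)
open EulerianGeneratingFunction using (eulerian-series)
open FlowPolytopeVertices using (vertex-count)

proposition7p7 : (n' : ℕ) →
    Σ (ℕ → ℕ) (λ v →
      (v zero ≡ 1)
      × (∀ m → HasVertexCount n' (suc m) aVec bVec (v (suc m)))
      × (∀ d → ((oneMinusX ^ˢ suc (suc n')) · (λ m → + (v m))) d ≡ eulerNumerator (suc n') d))
proposition7p7 n' = (λ m → suc m ^ suc n') , ^-zeroˡ (suc n') , vertex-count n' , eulerian-series n'
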